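{- Let $S=\{132,231,321\}$. Then $t_n(S)=n!$ for all $n\ge1$, the exponential generating functions satisfy $T(x)=\sum_{n\ge0}\frac{t_n(S)}{n!}x^n=\frac{x}{1-x}$ and $F(x)=\sum_{n\ge0}\frac{f_n(S)}{n!}x^n=e^{x/(1-x)}$, and $\lim_{n\to\infty}\frac{f_n(S)^{1/n}}{n}=e^{ -1}$.
   Context: A pattern of length $k$ is a permutation of $[k]$. A rooted forest on $[n]$ is a (possibly empty) unordered forest on $n$ vertices with distinguished roots of components and vertices labeled bijectively by $[n]$; a rooted tree on $[n]$ is such a forest with exactly one component (so $t_0(S)=0$). An instance of $\pi$ is a sequence of vertices $v_1,\dots,v_k$ with $v_i$ a strict ancestor of $v_{i+1}$ and labels in the same relative order as $\pi$; a forest avoids $S$ if it has no instance of any pattern of $S$. $f_n(S)$ and $t_n(S)$ denote the numbers of rooted forests and rooted trees on $[n]$ avoiding $S$. -}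

module Defs where

open import Data.Bool using (Bool; true; false; _∧_; not; if_then_else_)
open import Data.Nat using (ℕ; zero; suc; _<ᵇ_; _≡ᵇ_; _!; _≥_)
import Data.Nat.Properties as ℕP
open import Data.Fin using (Fin; toℕ)
import Data.Fin as Fin
open import Data.Maybe using (Maybe; just; nothing; maybe; is-nothing)
open import Data.List using (List; []; _∷_; length; filter; map; concatMap; zip; upTo; allFin)
open import Data.Bool.ListAction using (all; any)
open import Data.Vec using (Vec; lookup; toList)
import Data.Vec as Vec
open import Data.Product using (_×_; _,_; proj₁; proj₂; Σ; ∃)
open import Data.Sum using (_⊎_)
open import Data.Integer using (+_)
open import Data.Rational using (ℚ; 0ℚ; 1ℚ; _+_; _*_; _-_; _<_; _≤_; _/_)
open import Relation.Nullary.Decidable using (⌊_⌋)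
open import Relation.Binary.PropositionalEquality using (_≡_)

allVecs : {A : Set} → List A → (k : ℕ) → List (Vec A k)
allVecs xs zero    = Vec.[] ∷ []
allVecs xs (suc k) = concatMap (λ x → map (x Vec.∷_) (allVecs xs k)) xs

_==ꟳ_ : {n : ℕ} → Fin n → Fin n → Bool
u ==ꟳ v = ⌊ u Fin.≟ v ⌋

_==ᴮ_ : Bool → Bool → Bool
true  ==ᴮ b = b
false ==ᴮ b = not b

-- Rooted forests on [n] (vertex i : Fin n carries label toℕ i + 1).
-- A rooted forest is encoded by its parent vector: entry v is
-- 'nothing' if v is a root and 'just u' if u is the parent of v.
-- This encoding is a bijection between labelled rooted forests and
-- acyclic parent vectors.

Parents : ℕ → Set
Parents n = Vec (Maybe (Fin n)) n

up : {n : ℕ} → Parents n → ℕ → Fin n → Maybe (Fin n)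
up p zero    v = just v
up p (suc k) v = maybe (lookup p) nothing (up p k v)

-- acyclic: every vertex reaches "above a root" in n steps
isForest : {n : ℕ} → Parents n → Bool
isForest {n} p = all (λ v → is-nothing (up p n v)) (allFin n)

numRoots : {n : ℕ} → Parents n → ℕ
numRoots {n} p = length (filter (λ v → is-nothing (lookup p v) Data.Bool.≟ true) (allFin n))
  where import Data.Bool

isTree : {n : ℕ} → Parents n → Bool
isTree p = isForest p ∧ (numRoots p ≡ᵇ 1)

sanc : {n : ℕ} → Parents n → Fin n → Fin n → Bool
sanc {n} p u v = any (λ k → maybe (λ w → w ==ꟳ u) false (up p (suc k) v)) (upTo n)

isChain : {n : ℕ} → Parents n → List (Fin n) → Bool
isChain p []             = true
isChain p (u ∷ [])       = true
isChain p (u ∷ v ∷ rest) = sanc p u v ∧ isChain p (v ∷ rest)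

sameOrder : List ℕ → List ℕ → Bool
sameOrder xs ys =
  let zs = zip xs ys in
  all (λ a → all (λ b → (proj₁ a <ᵇ proj₁ b) ==ᴮ (proj₂ a <ᵇ proj₂ b)) zs) zs

-- a pattern is given in one-line notation (π(1) … π(k))
Pattern : Set
Pattern = List ℕ

hasInstance : {n : ℕ} → Parents n → Pattern → Bool
hasInstance {n} p π =
  any (λ vs → isChain p (toList vs) ∧ sameOrder π (map toℕ (toList vs)))
      (allVecs (allFin n) (length π))

avoids : {n : ℕ} → Parents n → List Pattern → Bool
avoids p S = not (any (hasInstance p) S)

allParents : (n : ℕ) → List (Parents n)
allParents n = allVecs (nothing ∷ map just (allFin n)) n

f : List Pattern → ℕ → ℕ
f S n = length (filter (λ p → isForest p ∧ avoids p S Data.Bool.≟ true) (allParents n))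
  where import Data.Bool

t : List Pattern → ℕ → ℕ
t S n = length (filter (λ p → isTree p ∧ avoids p S Data.Bool.≟ true) (allParents n))
  where import Data.Bool

S₀ : List Pattern
S₀ = (1 ∷ 3 ∷ 2 ∷ []) ∷ (2 ∷ 3 ∷ 1 ∷ []) ∷ (3 ∷ 2 ∷ 1 ∷ []) ∷ []

FPS : Set
FPS = ℕ → ℚ

sumBelow : ℕ → (ℕ → ℚ) → ℚ
sumBelow zero    g = 0ℚ
sumBelow (suc n) g = sumBelow n g + g n

_·_ : FPS → FPS → FPS
(a · b) n = sumBelow (suc n) (λ i → a i * b (n Data.Nat.∸ i))

powS : FPS → ℕ → FPS
powS a zero    = λ n → if n ≡ᵇ 0 then 1ℚ else 0ℚ
powS a (suc k) = a · powS a k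

invFact : ℕ → ℚ
invFact k = (+ 1) / (k !) where instance _ = k ℕP.!≢0

-- exp of a series with zero constant term: Σ_k G^k / k!
-- (the coefficient of x^n only involves k ≤ n)
expS : FPS → FPS
expS g n = sumBelow (suc n) (λ k → invFact k * powS g k n)

egf : (ℕ → ℕ) → FPS
egf a n = ((+ a n) / (n !)) where instance _ = n ℕP.!≢0

xOver1mx : FPS
xOver1mx n = if n ≡ᵇ 0 then 0ℚ else 1ℚ

-- Real-number facts encoded via rationals.
-- e = sup_m s_m where s_m = Σ_{k<m} 1/k!.

eSum : ℕ → ℚ
eSum m = sumBelow m invFact

-- p < 1/e  ⟺  p·e < 1  ⟺  ∃ r < 1, ∀ m, p·s_m ≤ r
BelowInvE : ℚ → Set
BelowInvE p = Σ ℚ (λ r → (r < 1ℚ) × ((m : ℕ) → p * eSum m ≤ r))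

-- 1/e < q  ⟺  q·e > 1  ⟺  ∃ m, q·s_m > 1
AboveInvE : ℚ → Set
AboveInvE q = Σ ℕ (λ m → 1ℚ < q * eSum m)

powQ : ℚ → ℕ → ℚ
powQ x zero    = 1ℚ
powQ x (suc k) = x * powQ x k

fromℕQ : ℕ → ℚ
fromℕQ n = (+ n) / 1

-- For n ≥ 1 and a ≥ 0:  p < a^(1/n)/n  ⟺  p < 0 or (p·n)^n < a
LtRootOver : ℚ → ℕ → ℕ → Set
LtRootOver p a n = (p < 0ℚ) ⊎ (powQ (p * fromℕQ n) n < fromℕQ a)

-- a^(1/n)/n < q  ⟺  0 < q and a < (q·n)^n
RootOverLt : ℕ → ℕ → ℚ → Set
RootOverLt a n q = (0ℚ < q) × (fromℕQ a < powQ (q * fromℕQ n) n)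

-- lim_{n→∞} a_n^{1/n}/n = 1/e, stated as: for all rationals p < 1/e < q,
-- eventually p < a_n^{1/n}/n < q.
RootOverNTendsToInvE : (ℕ → ℕ) → Set
RootOverNTendsToInvE a =
  (p q : ℚ) → BelowInvE p → AboveInvE q →
  Σ ℕ (λ N → (n : ℕ) → n ≥ N → n ≥ 1 → LtRootOver p (a n) n × RootOverLt (a n) n q)

module Submission where

-- A forest avoids 132, 231 and 321 exactly when every vertex whose parent is not a root has a larger
-- label than its parent; children of roots are unconstrained. Fixing the a roots, the other b = n − a
-- vertices are attached in increasing label order, the j-th one below a root or an earlier vertex, so
-- f_n = Σ_{a+b=n} C(n,a) a(a+1)⋯(a+b−1), and only a = 1 contributes to t_n = n!. As
-- [xⁿ](x/(1−x))ᵏ = C(n−1,k−1), the same sum is n! [xⁿ] exp(x/(1−x)). For the growth rate,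
-- n! = t_n ≤ f_n ≤ n! Σ_k C(n,k)/k! ≤ n! Dᴰ (1 + 1/D)ⁿ for every D ≥ 1, and n! is compared with (n/e)ⁿ
-- through (1 + 1/n)ⁿ ≤ e on one side and e_m ≤ (1 + 1/k)ᵏ for large k on the other, e_m being the
-- partial sums of e.

open import Defs
open import Data.Nat using (ℕ; _≥_; _!)
open import Data.Product using (_×_; _,_; proj₁; proj₂)
open import Relation.Binary.PropositionalEquality using (_≡_)

module BoolList where

  open import Defs using (allVecs)
  open import Data.Bool using (Bool; true; false; _∨_)
  open import Data.Bool.Properties using (∧-zeroʳ)
  open import Data.Bool.ListAction using (all; any)
  open import Data.Nat using (ℕ; zero; suc)
  open import Data.List using (List; []; _∷_; map; concatMap; _++_)
  open import Data.List.Membership.Propositional using (_∈_)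
  open import Data.List.Relation.Unary.Any using (here; there)
  open import Data.Vec using (Vec) renaming (_∷_ to _∷ᵛ_; [] to []ᵛ)
  open import Data.Product using (Σ; _,_)
  open import Relation.Binary.PropositionalEquality

  private
    variable
      A B : Set

  all-∈ : (g : A → Bool) (xs : List A) {x : A} → all g xs ≡ true → x ∈ xs → g x ≡ true
  all-∈ g (y ∷ ys) e (here refl) with g y
  ... | true = refl
  all-∈ g (y ∷ ys) e (there x∈ys) with g y
  ... | true = all-∈ g ys e x∈ys

  all-intro : (g : A → Bool) (xs : List A) → (∀ x → g x ≡ true) → all g xs ≡ true
  all-intro g [] h = refl
  all-intro g (y ∷ ys) h rewrite h y = all-intro g ys h

  all-∈-false : (g : A → Bool) (xs : List A) {x : A} → x ∈ xs → g x ≡ false → all g xs ≡ false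
  all-∈-false g (y ∷ ys) (here refl) e rewrite e = refl
  all-∈-false g (y ∷ ys) (there x∈ys) e rewrite all-∈-false g ys x∈ys e = ∧-zeroʳ (g y)

  any-false : (g : A → Bool) (xs : List A) → (∀ x → g x ≡ false) → any g xs ≡ false
  any-false g [] h = refl
  any-false g (y ∷ ys) h rewrite h y = any-false g ys h

  any-∈ : (g : A → Bool) (xs : List A) {x : A} → x ∈ xs → g x ≡ true → any g xs ≡ true
  any-∈ g (y ∷ ys) (here refl) e rewrite e = refl
  any-∈ g (y ∷ ys) (there x∈ys) e with g y
  ... | true = refl
  ... | false = any-∈ g ys x∈ys e

  any-witness : (g : A → Bool) (xs : List A) → any g xs ≡ true → Σ A (λ x → g x ≡ true)
  any-witness g (y ∷ ys) e with g y in gy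
  ... | true = y , gy
  ... | false = any-witness g ys e

  any-map : (g : B → Bool) (h : A → B) (xs : List A) → any g (map h xs) ≡ any (λ x → g (h x)) xs
  any-map g h [] = refl
  any-map g h (x ∷ xs) rewrite any-map g h xs = refl

  any-++ : (g : A → Bool) (xs ys : List A) → any g (xs ++ ys) ≡ (any g xs ∨ any g ys)
  any-++ g [] ys = refl
  any-++ g (x ∷ xs) ys with g x
  ... | true = refl
  ... | false = any-++ g xs ys

  any-concatMap : (g : B → Bool) (h : A → List B) (xs : List A) →
    any g (concatMap h xs) ≡ any (λ x → any g (h x)) xs
  any-concatMap g h [] = refl
  any-concatMap g h (x ∷ xs) rewrite any-++ g (h x) (concatMap h xs) | any-concatMap g h xs = refl

  any-allVecs : (xs : List A) → (∀ a → a ∈ xs) → (k : ℕ) (g : Vec A k → Bool) (vs : Vec A k) →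
    g vs ≡ true → any g (allVecs xs k) ≡ true
  any-allVecs xs complete zero g []ᵛ e rewrite e = refl
  any-allVecs xs complete (suc k) g (a ∷ᵛ vs) e
    rewrite any-concatMap g (λ x → map (x ∷ᵛ_) (allVecs xs k)) xs =
    any-∈ (λ x → any g (map (x ∷ᵛ_) (allVecs xs k))) xs (complete a)
      (trans (any-map g (a ∷ᵛ_) (allVecs xs k)) (any-allVecs xs complete k (λ ws → g (a ∷ᵛ ws)) vs e))

module Avoidance where

  open import Defs
  open BoolList
  open import Data.Bool using (Bool; true; false; _∧_; not)
  open import Data.Bool.ListAction using (all)
  open import Data.Bool.Properties using (T-≡)
  open import Function.Bundles using (Equivalence)
  open import Data.Nat using (ℕ; zero; suc; _+_; _∸_; _<ᵇ_; _≤_; _<_; z≤n; s≤s)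
  open import Data.Nat.Properties
  open import Data.Fin using (Fin; toℕ)
  import Data.Fin as Fin
  open import Data.Fin.Properties using (toℕ-injective; toℕ<n)
  open import Data.Maybe using (just; nothing; maybe; is-nothing)
  open import Data.List using (List; []; _∷_; map; upTo; allFin; zip)
  open import Data.List.Membership.Propositional using (_∈_)
  open import Data.List.Membership.Propositional.Properties using (∈-allFin)
  open import Data.List.Relation.Unary.Any using (here; there)
  open import Data.Vec using (Vec; lookup; toList) renaming (_∷_ to _∷ᵛ_; [] to []ᵛ)
  open import Data.Product using (Σ; _×_; _,_; proj₁; proj₂)
  open import Data.Sum using (_⊎_; inj₁; inj₂; [_,_]′)
  open import Data.Empty using (⊥; ⊥-elim)
  open import Relation.Nullary using (yes; no)
  open import Relation.Binary.PropositionalEquality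
  open import Relation.Binary using (tri<; tri≈; tri>)

  <ᵇ-true⇒< : ∀ m n → (m <ᵇ n) ≡ true → m < n
  <ᵇ-true⇒< m n e = <ᵇ⇒< m n (Equivalence.from T-≡ e)

  <⇒<ᵇ-true : ∀ {m n} → m < n → (m <ᵇ n) ≡ true
  <⇒<ᵇ-true m<n = Equivalence.to T-≡ (<⇒<ᵇ m<n)

  ≤⇒<ᵇ-false : ∀ {m n} → n ≤ m → (m <ᵇ n) ≡ false
  ≤⇒<ᵇ-false {m} {zero} _ = refl
  ≤⇒<ᵇ-false (s≤s n≤m) = ≤⇒<ᵇ-false n≤m

  <ᵇ-false⇒≥ : ∀ m n → (m <ᵇ n) ≡ false → n ≤ m
  <ᵇ-false⇒≥ m zero e = z≤n
  <ᵇ-false⇒≥ (suc m) (suc n) e = s≤s (<ᵇ-false⇒≥ m n e)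

  ==ꟳ-refl : {n : ℕ} (u : Fin n) → (u ==ꟳ u) ≡ true
  ==ꟳ-refl u with u Fin.≟ u
  ... | yes _ = refl
  ... | no u≢u = ⊥-elim (u≢u refl)

  ==ꟳ-true⇒≡ : {n : ℕ} (u w : Fin n) → (w ==ꟳ u) ≡ true → w ≡ u
  ==ꟳ-true⇒≡ u w e with w Fin.≟ u
  ... | yes w≡u = w≡u

  increasingAt : {n : ℕ} → Parents n → Fin n → Bool
  increasingAt p v = maybe (λ u → maybe (λ _ → toℕ u <ᵇ toℕ v) true (lookup p u)) true (lookup p v)

  increasing : {n : ℕ} → Parents n → Bool
  increasing {n} p = all (increasingAt p) (allFin n)

  Increasing : {n : ℕ} → Parents n → Set
  Increasing p = ∀ v → increasingAt p v ≡ true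

  increasing⇒Increasing : {n : ℕ} (p : Parents n) → increasing p ≡ true → Increasing p
  increasing⇒Increasing {n} p e v = all-∈ (increasingAt p) (allFin n) e (∈-allFin v)

  module _ {n : ℕ} (p : Parents n) where

    Increasing-parent< : Increasing p → ∀ {v u x} → lookup p v ≡ just u → lookup p u ≡ just x → toℕ u < toℕ v
    Increasing-parent< inc {v} {u} {x} pv pu = <ᵇ-true⇒< _ _ u<ᵇv
      where
      u<ᵇv : (toℕ u <ᵇ toℕ v) ≡ true
      u<ᵇv with inc v
      ... | r rewrite pv | pu = r

    up-+ : ∀ j i v → up p (j + i) v ≡ maybe (up p j) nothing (up p i v)
    up-+ zero i v with up p i v
    ... | nothing = refl
    ... | just a = refl
    up-+ (suc j) i v rewrite up-+ j i v with up p i v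
    ... | nothing = refl
    ... | just a = refl

    up-suc : ∀ k v → up p (suc k) v ≡ maybe (up p k) nothing (lookup p v)
    up-suc k v = trans (cong (λ t → up p t v) (+-comm 1 k)) (up-+ k 1 v)

    up-suc⇒nonroot : ∀ k {v w} → up p (suc k) v ≡ just w → Σ (Fin n) λ u → lookup p v ≡ just u
    up-suc⇒nonroot k {v} e with lookup p v | trans (sym (up-suc k v)) e
    ... | just u | _ = u , refl

    Increasing-depth+label≤ : Increasing p → ∀ k {v w x} → up p k v ≡ just w → lookup p w ≡ just x →
      k + toℕ w ≤ toℕ v
    Increasing-depth+label≤ inc zero refl _ = ≤-refl
    Increasing-depth+label≤ inc (suc k) {v} e pw with up p k v in upk
    ... | just a = ≤-trans (+-monoʳ-< k (Increasing-parent< inc e pw)) (Increasing-depth+label≤ inc k upk e)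

    up-+-defined : ∀ j i v {w} → up p (j + i) v ≡ just w → Σ (Fin n) λ b → up p i v ≡ just b
    up-+-defined j i v e with up p i v | up-+ j i v
    ... | just b | _ = b , refl
    ... | nothing | eq with trans (sym eq) e
    ...   | ()

    up-suc-defined : ∀ i v {b} → up p (suc i) v ≡ just b →
      Σ (Fin n) λ a → (up p i v ≡ just a) × (lookup p a ≡ just b)
    up-suc-defined i v e with up p i v
    ... | just a = a , refl , e

    up-nonroot-before : ∀ m i v {w} → i ≤ m → up p (suc m) v ≡ just w →
      Σ (Fin n) λ a → (up p i v ≡ just a) × Σ (Fin n) λ b → lookup p a ≡ just b
    up-nonroot-before m i v i≤m e with up-+-defined (m ∸ i) (suc i) v (trans reach e)
      where
      reach : up p (m ∸ i + suc i) v ≡ up p (suc m) v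
      reach = cong (λ t → up p t v) (trans (+-suc (m ∸ i) i) (cong suc (m∸n+n≡m i≤m)))
    ... | b , e′ with up-suc-defined i v e′
    ...   | a , upi , pa = a , upi , b , pa

  -- If the endpoint w is not a root, labels drop m + 1 times inside [0, m]. If w is a root, the
  -- ancestor at step m ∸ ℓ(w) is squeezed to the label ℓ(w), hence equals w, yet it has a parent.
  Increasing-no-path-of-length-n : {m : ℕ} (p : Parents (suc m)) → Increasing p →
    ∀ v {w} → up p (suc m) v ≡ just w → ⊥
  Increasing-no-path-of-length-n {m} p inc v {w} e with lookup p w in pw
  ... | just x = <⇒≱ (toℕ<n v) (≤-trans (s≤s (m≤m+n m (toℕ w))) (Increasing-depth+label≤ p inc (suc m) e pw))
  ... | nothing with up-nonroot-before p m (m ∸ toℕ w) v (m∸n≤m m (toℕ w)) e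
                   | up-nonroot-before p m m v ≤-refl e
  ...   | a , upa , b , pa | aₘ , upaₘ , _ , paₘ = nothing≢just (trans (sym pw) (subst (λ u → lookup p u ≡ just b) a≡w pa))
    where
    ℓ = toℕ w
    i = m ∸ ℓ
    nothing≢just : nothing ≡ just b → ⊥
    nothing≢just ()
    ℓ≤m : ℓ ≤ m
    ℓ≤m = ≤-pred (toℕ<n w)
    a-to-aₘ : up p (m ∸ i) a ≡ just aₘ
    a-to-aₘ = trans (sym (cong (maybe (up p (m ∸ i)) nothing) upa))
                (trans (sym (up-+ p (m ∸ i) i v)) (trans (cong (λ t → up p t v) (m∸n+n≡m (m∸n≤m m ℓ))) upaₘ))
    ℓ≤a : ℓ ≤ toℕ a
    ℓ≤a = ≤-trans (subst (λ t → t ≤ m ∸ i + toℕ aₘ) (m∸[m∸n]≡n ℓ≤m) (m≤m+n (m ∸ i) (toℕ aₘ)))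
                  (Increasing-depth+label≤ p inc (m ∸ i) a-to-aₘ paₘ)
    a≤ℓ : i + toℕ a ≤ i + ℓ
    a≤ℓ = ≤-trans (Increasing-depth+label≤ p inc i upa pa)
                  (≤-trans (≤-pred (toℕ<n v)) (≤-reflexive (sym (m∸n+n≡m ℓ≤m))))
    a≡w : a ≡ w
    a≡w = toℕ-injective (≤-antisym (+-cancelˡ-≤ i _ _ a≤ℓ) ℓ≤a)

  Increasing⇒isForest : {n : ℕ} (p : Parents n) → Increasing p → isForest p ≡ true
  Increasing⇒isForest {zero} p inc = refl
  Increasing⇒isForest {suc m} p inc = all-intro _ (allFin (suc m)) reaches-root
    where
    reaches-root : ∀ v → is-nothing (up p (suc m) v) ≡ true
    reaches-root v with up p (suc m) v in e
    ... | nothing = refl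
    ... | just w = ⊥-elim (Increasing-no-path-of-length-n p inc v e)

  Forest : {n : ℕ} → Parents n → Set
  Forest {n} p = ∀ v → is-nothing (up p n v) ≡ true

  isForest⇒Forest : {n : ℕ} (p : Parents n) → isForest p ≡ true → Forest p
  isForest⇒Forest {n} p e v = all-∈ _ (allFin n) e (∈-allFin v)

  module _ {n : ℕ} (p : Parents n) (forest : Forest p) where

    up-n-undefined : ∀ v {w} → up p n v ≡ just w → ⊥
    up-n-undefined v e with up p n v | forest v
    up-n-undefined v refl | just _ | ()

    parent≢self : ∀ {u} → lookup p u ≡ just u → ⊥
    parent≢self {u} pu = up-n-undefined u (loop n)
      where
      loop : ∀ k → up p k u ≡ just u
      loop zero = refl
      loop (suc k) rewrite loop k = pu

    no-2-cycle : ∀ {u v} → lookup p v ≡ just u → lookup p u ≡ just v → ⊥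
    no-2-cycle {u} {v} pv pu = [ up-n-undefined v , up-n-undefined v ]′ (loop n)
      where
      loop : ∀ k → (up p k v ≡ just v) ⊎ (up p k v ≡ just u)
      loop zero = inj₁ refl
      loop (suc k) with loop k
      ... | inj₁ e rewrite e = inj₂ pv
      ... | inj₂ e rewrite e = inj₁ pu

  module _ {n : ℕ} (p : Parents n) where

    sanc⇒up : ∀ u v → sanc p u v ≡ true → Σ ℕ λ k → up p (suc k) v ≡ just u
    sanc⇒up u v e with any-witness _ (upTo n) e
    ... | k , hit with up p (suc k) v in upk
    ...   | just w rewrite ==ꟳ-true⇒≡ u w hit = k , upk

  parent⇒sanc : {m : ℕ} (p : Parents (suc m)) → ∀ {u v} → lookup p v ≡ just u → sanc p u v ≡ true
  parent⇒sanc {m} p {u} {v} pv = any-∈ (λ k → maybe (λ w → w ==ꟳ u) false (up p (suc k) v)) (upTo (suc m)) (here refl) hit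
    where
    hit : maybe (λ w → w ==ꟳ u) false (up p 1 v) ≡ true
    hit rewrite pv = ==ꟳ-refl u

  -- In a chain x, y, z the vertex y has the ancestor x, so it is not a root, and in an increasing
  -- forest labels then increase strictly along the path from y down to z.
  Increasing⇒no-descending-end : {n : ℕ} (p : Parents n) → Increasing p →
    ∀ a b c → (b <ᵇ c) ≡ false → hasInstance p (a ∷ b ∷ c ∷ []) ≡ false
  Increasing⇒no-descending-end {n} p inc a b c b≮c = any-false _ (allVecs (allFin n) 3) no-instance
    where
    no-instance : (vs : Vec (Fin n) 3) →
      (isChain p (toList vs) ∧ sameOrder (a ∷ b ∷ c ∷ []) (map toℕ (toList vs))) ≡ false
    no-instance (x ∷ᵛ y ∷ᵛ z ∷ᵛ []ᵛ) with sanc p x y in x≺y | sanc p y z in y≺z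
    ... | false | _ = refl
    ... | true | false = refl
    ... | true | true =
      all-∈-false (λ i → all (cmp i) pairs) pairs (there (here refl))
        (all-∈-false (cmp (b , toℕ y)) pairs (there (there (here refl))) order-differs)
      where
      pairs = zip (a ∷ b ∷ c ∷ []) (toℕ x ∷ toℕ y ∷ toℕ z ∷ [])
      cmp : ℕ × ℕ → ℕ × ℕ → Bool
      cmp i j = (proj₁ i <ᵇ proj₁ j) ==ᴮ (proj₂ i <ᵇ proj₂ j)
      y<z : toℕ y < toℕ z
      y<z with sanc⇒up p x y x≺y | sanc⇒up p y z y≺z
      ... | k , upx | l , upy with up-suc⇒nonroot p k upx
      ...   | _ , py = ≤-trans (s≤s (m≤n+m (toℕ y) l)) (Increasing-depth+label≤ p inc (suc l) upy py)
      order-differs : ((b <ᵇ c) ==ᴮ (toℕ y <ᵇ toℕ z)) ≡ false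
      order-differs rewrite b≮c | <⇒<ᵇ-true y<z = refl

  Increasing⇒avoids-S₀ : {n : ℕ} (p : Parents n) → Increasing p → avoids p S₀ ≡ true
  Increasing⇒avoids-S₀ p inc
    rewrite Increasing⇒no-descending-end p inc 1 3 2 refl
          | Increasing⇒no-descending-end p inc 2 3 1 refl
          | Increasing⇒no-descending-end p inc 3 2 1 refl = refl

  private
    <ᵇ-irrefl : ∀ x → (x <ᵇ x) ≡ false
    <ᵇ-irrefl x = ≤⇒<ᵇ-false {x} ≤-refl

  sameOrder-132 : ∀ x y z → x < z → z < y → sameOrder (1 ∷ 3 ∷ 2 ∷ []) (x ∷ y ∷ z ∷ []) ≡ true
  sameOrder-132 x y z x<z z<y
    rewrite <ᵇ-irrefl x | <ᵇ-irrefl y | <ᵇ-irrefl z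
          | <⇒<ᵇ-true x<z | <⇒<ᵇ-true z<y | <⇒<ᵇ-true (<-trans x<z z<y)
          | ≤⇒<ᵇ-false (<⇒≤ x<z) | ≤⇒<ᵇ-false (<⇒≤ z<y) | ≤⇒<ᵇ-false (<⇒≤ (<-trans x<z z<y)) = refl

  sameOrder-231 : ∀ x y z → z < x → x < y → sameOrder (2 ∷ 3 ∷ 1 ∷ []) (x ∷ y ∷ z ∷ []) ≡ true
  sameOrder-231 x y z z<x x<y
    rewrite <ᵇ-irrefl x | <ᵇ-irrefl y | <ᵇ-irrefl z
          | <⇒<ᵇ-true z<x | <⇒<ᵇ-true x<y | <⇒<ᵇ-true (<-trans z<x x<y)
          | ≤⇒<ᵇ-false (<⇒≤ z<x) | ≤⇒<ᵇ-false (<⇒≤ x<y) | ≤⇒<ᵇ-false (<⇒≤ (<-trans z<x x<y)) = refl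

  sameOrder-321 : ∀ x y z → z < y → y < x → sameOrder (3 ∷ 2 ∷ 1 ∷ []) (x ∷ y ∷ z ∷ []) ≡ true
  sameOrder-321 x y z z<y y<x
    rewrite <ᵇ-irrefl x | <ᵇ-irrefl y | <ᵇ-irrefl z
          | <⇒<ᵇ-true z<y | <⇒<ᵇ-true y<x | <⇒<ᵇ-true (<-trans z<y y<x)
          | ≤⇒<ᵇ-false (<⇒≤ z<y) | ≤⇒<ᵇ-false (<⇒≤ y<x) | ≤⇒<ᵇ-false (<⇒≤ (<-trans z<y y<x)) = refl

  parent-chain⇒hasInstance : {m : ℕ} (p : Parents (suc m)) → ∀ a b c {w u v} →
    lookup p u ≡ just w → lookup p v ≡ just u →
    sameOrder (a ∷ b ∷ c ∷ []) (toℕ w ∷ toℕ u ∷ toℕ v ∷ []) ≡ true → hasInstance p (a ∷ b ∷ c ∷ []) ≡ true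
  parent-chain⇒hasInstance {m} p a b c {w} {u} {v} pu pv same =
    any-allVecs (allFin (suc m)) ∈-allFin 3
      (λ vs → isChain p (toList vs) ∧ sameOrder (a ∷ b ∷ c ∷ []) (map toℕ (toList vs)))
      (w ∷ᵛ u ∷ᵛ v ∷ᵛ []ᵛ) chain
    where
    chain : (sanc p w u ∧ (sanc p u v ∧ true)) ∧ sameOrder (a ∷ b ∷ c ∷ []) (toℕ w ∷ toℕ u ∷ toℕ v ∷ []) ≡ true
    chain rewrite parent⇒sanc p pu | parent⇒sanc p pv = same

  -- A violation v, u = parent v, w = parent u with v < u is an instance of 132, 231 or 321
  -- according to where w falls relative to v and u.
  Forest∧avoids-S₀⇒Increasing : {n : ℕ} (p : Parents n) → Forest p → avoids p S₀ ≡ true → Increasing p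
  Forest∧avoids-S₀⇒Increasing {zero} p forest avoid ()
  Forest∧avoids-S₀⇒Increasing {suc m} p forest avoid v with lookup p v in pv
  ... | nothing = refl
  ... | just u with lookup p u in pu
  ...   | nothing = refl
  ...   | just w with toℕ u <ᵇ toℕ v in u≮v
  ...     | true = refl
  ...     | false = ⊥-elim contradiction
    where
    occurs : ∀ {π} → π ∈ S₀ → hasInstance p π ≡ true → ⊥
    occurs π∈S₀ inst with trans (sym (cong not (any-∈ (hasInstance p) S₀ π∈S₀ inst))) avoid
    ... | ()
    distinct : ∀ {x y} → lookup p y ≡ just x → toℕ x ≢ toℕ y
    distinct px e with toℕ-injective e
    ... | refl = parent≢self p forest px
    v<u : toℕ v < toℕ u
    v<u = ≤∧≢⇒< (<ᵇ-false⇒≥ _ _ u≮v) (λ e → distinct pv (sym e))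
    contradiction : ⊥
    contradiction with <-cmp (toℕ w) (toℕ v)
    ... | tri≈ _ w≡v _ = no-2-cycle p forest pv (subst (λ x → lookup p u ≡ just x) (toℕ-injective w≡v) pu)
    ... | tri< w<v _ _ = occurs (here refl) (parent-chain⇒hasInstance p 1 3 2 pu pv (sameOrder-132 _ _ _ w<v v<u))
    ... | tri> _ _ v<w with <-cmp (toℕ w) (toℕ u)
    ...   | tri≈ _ w≡u _ = distinct pu w≡u
    ...   | tri< w<u _ _ = occurs (there (here refl)) (parent-chain⇒hasInstance p 2 3 1 pu pv (sameOrder-231 _ _ _ v<w w<u))
    ...   | tri> _ _ u<w = occurs (there (there (here refl))) (parent-chain⇒hasInstance p 3 2 1 pu pv (sameOrder-321 _ _ _ v<u u<w))

  forest∧avoids-S₀≡increasing : {n : ℕ} (p : Parents n) → (isForest p ∧ avoids p S₀) ≡ increasing p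
  forest∧avoids-S₀≡increasing {n} p with increasing p in inc
  ... | true rewrite Increasing⇒isForest p (increasing⇒Increasing p inc)
                   | Increasing⇒avoids-S₀ p (increasing⇒Increasing p inc) = refl
  ... | false with isForest p in forest | avoids p S₀ in avoid
  ...   | false | _ = refl
  ...   | true | false = refl
  ...   | true | true
    with trans (sym (all-intro (increasingAt p) (allFin n)
                       (Forest∧avoids-S₀⇒Increasing p (isForest⇒Forest p forest) avoid))) inc
  ...     | ()

module Counting where

  open import Defs using (allVecs)
  open import Data.Bool using (Bool; true; false; _∧_; _∨_; not)
  import Data.Bool as B
  open import Data.Bool.ListAction using (all)
  open import Data.Nat using (ℕ; zero; suc; _+_; _*_)
  open import Data.Nat.Properties
  open import Algebra.Properties.CommutativeSemigroup +-commutativeSemigroup using (interchange)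
  open import Data.Fin using (Fin) renaming (zero to fz; suc to fs)
  open import Data.List using (List; []; _∷_; map; concatMap; _++_; length; filter; tabulate)
  open import Data.Vec using (Vec; lookup) renaming (_∷_ to _∷ᵛ_; [] to []ᵛ)
  import Data.Vec as V
  open import Relation.Binary.PropositionalEquality

  private
    variable
      A B : Set

  indicator : Bool → ℕ
  indicator true = 1
  indicator false = 0

  count : (A → Bool) → List A → ℕ
  count g [] = 0
  count g (x ∷ xs) = indicator (g x) + count g xs

  sumOver : (A → ℕ) → List A → ℕ
  sumOver g [] = 0
  sumOver g (x ∷ xs) = g x + sumOver g xs

  length-filter : (g : A → Bool) (xs : List A) → length (filter (λ x → g x B.≟ true) xs) ≡ count g xs
  length-filter g [] = refl
  length-filter g (x ∷ xs) with g x
  ... | true = cong suc (length-filter g xs)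
  ... | false = length-filter g xs

  count-cong : {g h : A → Bool} (xs : List A) → (∀ x → g x ≡ h x) → count g xs ≡ count h xs
  count-cong [] e = refl
  count-cong (x ∷ xs) e = cong₂ _+_ (cong indicator (e x)) (count-cong xs e)

  sumOver-cong : {g h : A → ℕ} (xs : List A) → (∀ x → g x ≡ h x) → sumOver g xs ≡ sumOver h xs
  sumOver-cong [] e = refl
  sumOver-cong (x ∷ xs) e = cong₂ _+_ (e x) (sumOver-cong xs e)

  count-map : (g : B → Bool) (h : A → B) (xs : List A) → count g (map h xs) ≡ count (λ x → g (h x)) xs
  count-map g h [] = refl
  count-map g h (x ∷ xs) = cong (_ +_) (count-map g h xs)

  sumOver-map : (g : B → ℕ) (h : A → B) (xs : List A) → sumOver g (map h xs) ≡ sumOver (λ x → g (h x)) xs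
  sumOver-map g h [] = refl
  sumOver-map g h (x ∷ xs) = cong (_ +_) (sumOver-map g h xs)

  count-++ : (g : A → Bool) (xs ys : List A) → count g (xs ++ ys) ≡ count g xs + count g ys
  count-++ g [] ys = refl
  count-++ g (x ∷ xs) ys rewrite count-++ g xs ys = sym (+-assoc (indicator (g x)) _ _)

  sumOver-++ : (g : A → ℕ) (xs ys : List A) → sumOver g (xs ++ ys) ≡ sumOver g xs + sumOver g ys
  sumOver-++ g [] ys = refl
  sumOver-++ g (x ∷ xs) ys rewrite sumOver-++ g xs ys = sym (+-assoc (g x) _ _)

  count-concatMap : (g : B → Bool) (h : A → List B) (xs : List A) →
    count g (concatMap h xs) ≡ sumOver (λ x → count g (h x)) xs
  count-concatMap g h [] = refl
  count-concatMap g h (x ∷ xs) rewrite count-++ g (h x) (concatMap h xs) = cong (_ +_) (count-concatMap g h xs)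

  sumOver-+ : (g h : A → ℕ) (xs : List A) → sumOver (λ x → g x + h x) xs ≡ sumOver g xs + sumOver h xs
  sumOver-+ g h [] = refl
  sumOver-+ g h (x ∷ xs) rewrite sumOver-+ g h xs = interchange (g x) (h x) (sumOver g xs) (sumOver h xs)

  sumOver-zero : (xs : List A) → sumOver (λ _ → 0) xs ≡ 0
  sumOver-zero [] = refl
  sumOver-zero (_ ∷ xs) = sumOver-zero xs

  sumOver-indicator : (g : A → Bool) (xs : List A) → sumOver (λ x → indicator (g x)) xs ≡ count g xs
  sumOver-indicator g [] = refl
  sumOver-indicator g (x ∷ xs) = cong (_ +_) (sumOver-indicator g xs)

  sumOver-indicator-* : (g : A → Bool) (c : ℕ) (xs : List A) → sumOver (λ x → indicator (g x) * c) xs ≡ count g xs * c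
  sumOver-indicator-* g c [] = refl
  sumOver-indicator-* g c (x ∷ xs) rewrite sumOver-indicator-* g c xs = sym (*-distribʳ-+ c (indicator (g x)) (count g xs))

  count-∧ˡ : (b : Bool) (g : A → Bool) (xs : List A) → count (λ x → b ∧ g x) xs ≡ indicator b * count g xs
  count-∧ˡ true g xs = sym (+-identityʳ (count g xs))
  count-∧ˡ false g [] = refl
  count-∧ˡ false g (x ∷ xs) = count-∧ˡ false g xs

  count-swap : (M : A → B → Bool) (ys : List B) (xs : List A) →
    sumOver (λ x → count (M x) ys) xs ≡ sumOver (λ y → count (λ x → M x y) xs) ys
  count-swap M [] xs = sumOver-zero xs
  count-swap M (y ∷ ys) xs = trans (sumOver-+ (λ x → indicator (M x y)) (λ x → count (M x) ys) xs)
    (cong₂ _+_ (sumOver-indicator (λ x → M x y) xs) (count-swap M ys xs))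

  pointwise : {m : ℕ} → Vec (A → Bool) m → Vec A m → Bool
  pointwise []ᵛ []ᵛ = true
  pointwise (φ ∷ᵛ Φ) (x ∷ᵛ xs) = φ x ∧ pointwise Φ xs

  productOfCounts : {m : ℕ} → List A → Vec (A → Bool) m → ℕ
  productOfCounts xs []ᵛ = 1
  productOfCounts xs (φ ∷ᵛ Φ) = count φ xs * productOfCounts xs Φ

  count-pointwise : (xs : List A) (m : ℕ) (Φ : Vec (A → Bool) m) →
    count (pointwise Φ) (allVecs xs m) ≡ productOfCounts xs Φ
  count-pointwise xs zero []ᵛ = refl
  count-pointwise xs (suc m) (φ ∷ᵛ Φ) = begin
      count (pointwise (φ ∷ᵛ Φ)) (concatMap (λ x → map (x ∷ᵛ_) (allVecs xs m)) xs)
    ≡⟨ count-concatMap _ _ xs ⟩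
      sumOver (λ x → count (pointwise (φ ∷ᵛ Φ)) (map (x ∷ᵛ_) (allVecs xs m))) xs
    ≡⟨ sumOver-cong xs (λ x → trans (count-map (pointwise (φ ∷ᵛ Φ)) (x ∷ᵛ_) (allVecs xs m))
                                      (count-∧ˡ (φ x) (pointwise Φ) (allVecs xs m))) ⟩
      sumOver (λ x → indicator (φ x) * count (pointwise Φ) (allVecs xs m)) xs
    ≡⟨ sumOver-indicator-* φ _ xs ⟩
      count φ xs * count (pointwise Φ) (allVecs xs m)
    ≡⟨ cong (count φ xs *_) (count-pointwise xs m Φ) ⟩
      count φ xs * productOfCounts xs Φ ∎
    where open ≡-Reasoning

  allF : (n : ℕ) → (Fin n → Bool) → Bool
  allF zero g = true
  allF (suc n) g = g fz ∧ allF n (λ v → g (fs v))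

  countF : (n : ℕ) → (Fin n → Bool) → ℕ
  countF zero g = 0
  countF (suc n) g = indicator (g fz) + countF n (λ v → g (fs v))

  prodF : (n : ℕ) → (Fin n → ℕ) → ℕ
  prodF zero g = 1
  prodF (suc n) g = g fz * prodF n (λ v → g (fs v))

  all-tabulate : (n : ℕ) (g : A → Bool) (f : Fin n → A) → all g (tabulate f) ≡ allF n (λ v → g (f v))
  all-tabulate zero g f = refl
  all-tabulate (suc n) g f = cong (g (f fz) ∧_) (all-tabulate n g (λ v → f (fs v)))

  count-tabulate : (n : ℕ) (g : A → Bool) (f : Fin n → A) → count g (tabulate f) ≡ countF n (λ v → g (f v))
  count-tabulate zero g f = refl
  count-tabulate (suc n) g f = cong (indicator (g (f fz)) +_) (count-tabulate n g (λ v → f (fs v)))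

  allF-cong : (n : ℕ) {g h : Fin n → Bool} → (∀ v → g v ≡ h v) → allF n g ≡ allF n h
  allF-cong zero e = refl
  allF-cong (suc n) e = cong₂ _∧_ (e fz) (allF-cong n (λ v → e (fs v)))

  countF-cong : (n : ℕ) {g h : Fin n → Bool} → (∀ v → g v ≡ h v) → countF n g ≡ countF n h
  countF-cong zero e = refl
  countF-cong (suc n) e = cong₂ _+_ (cong indicator (e fz)) (countF-cong n (λ v → e (fs v)))

  prodF-cong : (n : ℕ) {g h : Fin n → ℕ} → (∀ v → g v ≡ h v) → prodF n g ≡ prodF n h
  prodF-cong zero e = refl
  prodF-cong (suc n) e = cong₂ _*_ (e fz) (prodF-cong n (λ v → e (fs v)))

  allF-true : (n : ℕ) (g : Fin n → Bool) → allF n g ≡ true → ∀ v → g v ≡ true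
  allF-true (suc n) g e fz with g fz | e
  ... | true | _ = refl
  allF-true (suc n) g e (fs v) with g fz | e
  ... | true | e′ = allF-true n (λ w → g (fs w)) e′ v

  allF-∧ : (n : ℕ) (g h : Fin n → Bool) → allF n (λ v → g v ∧ h v) ≡ allF n g ∧ allF n h
  allF-∧ zero g h = refl
  allF-∧ (suc n) g h rewrite allF-∧ n (λ v → g (fs v)) (λ v → h (fs v)) with g fz | h fz
  ... | true | true = refl
  ... | true | false with allF n (λ v → g (fs v))
  ...   | true = refl
  ...   | false = refl
  allF-∧ (suc n) g h | false | _ = refl

  allF-pointwise : (n : ℕ) (Φ : Fin n → A → Bool) (vs : Vec A n) →
    allF n (λ v → Φ v (lookup vs v)) ≡ pointwise (V.tabulate Φ) vs
  allF-pointwise zero Φ []ᵛ = refl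
  allF-pointwise (suc n) Φ (x ∷ᵛ vs) = cong (Φ fz x ∧_) (allF-pointwise n (λ v → Φ (fs v)) vs)

  productOfCounts-tabulate : (xs : List A) (n : ℕ) (Φ : Fin n → A → Bool) →
    productOfCounts xs (V.tabulate Φ) ≡ prodF n (λ v → count (Φ v) xs)
  productOfCounts-tabulate xs zero Φ = refl
  productOfCounts-tabulate xs (suc n) Φ = cong (count (Φ fz) xs *_) (productOfCounts-tabulate xs n (λ v → Φ (fs v)))

  count-allF : (xs : List A) (n : ℕ) (Φ : Fin n → A → Bool) →
    count (λ vs → allF n (λ v → Φ v (lookup vs v))) (allVecs xs n) ≡ prodF n (λ v → count (Φ v) xs)
  count-allF xs n Φ = begin
      count (λ vs → allF n (λ v → Φ v (lookup vs v))) (allVecs xs n)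
    ≡⟨ count-cong (allVecs xs n) (allF-pointwise n Φ) ⟩
      count (pointwise (V.tabulate Φ)) (allVecs xs n)
    ≡⟨ count-pointwise xs n (V.tabulate Φ) ⟩
      productOfCounts xs (V.tabulate Φ)
    ≡⟨ productOfCounts-tabulate xs n Φ ⟩
      prodF n (λ v → count (Φ v) xs) ∎
    where open ≡-Reasoning

  prodF-1 : (n : ℕ) → prodF n (λ _ → 1) ≡ 1
  prodF-1 zero = refl
  prodF-1 (suc n) rewrite prodF-1 n = refl

  countF-false : (n : ℕ) → countF n (λ _ → false) ≡ 0
  countF-false zero = refl
  countF-false (suc n) = countF-false n

  countF-∨ : (n : ℕ) (g h : Fin n → Bool) → countF n (λ v → g v ∨ h v) ≡ countF n g + countF n (λ v → not (g v) ∧ h v)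
  countF-∨ zero g h = refl
  countF-∨ (suc n) g h rewrite countF-∨ n (λ v → g (fs v)) (λ v → h (fs v)) with g fz | h fz
  ... | true | _ = sym (+-assoc 1 (countF n (λ v → g (fs v))) _)
  ... | false | true = sym (+-suc _ _)
  ... | false | false = refl

module Binomial where

  open import Data.Nat using (ℕ; zero; suc; _+_; _*_; _^_; _!; _≤_; _<_; z≤n; s≤s; _≤?_; >-nonZero)
  open import Data.Nat.Properties
  open import Data.Nat.Solver using (module +-*-Solver)
  open import Algebra.Properties.CommutativeSemigroup +-commutativeSemigroup using (interchange)
  open import Algebra.Properties.CommutativeSemigroup *-commutativeSemigroup using (x∙yz≈y∙xz)
  open import Relation.Nullary using (yes; no)
  open import Relation.Binary.PropositionalEquality

  -- Pascal's recursion, so that it computes by pattern matching (unlike Data.Nat.Combinatorics._C_).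
  choose : ℕ → ℕ → ℕ
  choose n zero = 1
  choose zero (suc k) = 0
  choose (suc n) (suc k) = choose n k + choose n (suc k)

  choose-≡0 : ∀ n k → n < k → choose n k ≡ 0
  choose-≡0 zero (suc k) _ = refl
  choose-≡0 (suc n) (suc k) (s≤s n<k)
    rewrite choose-≡0 n k n<k | choose-≡0 n (suc k) (≤-trans n<k (n≤1+n k)) = refl

  choose-1 : ∀ n → choose n 1 ≡ n
  choose-1 zero = refl
  choose-1 (suc n) = cong suc (choose-1 n)

  choose-diag : ∀ n → choose n n ≡ 1
  choose-diag zero = refl
  choose-diag (suc n) rewrite choose-diag n | choose-≡0 n (suc n) ≤-refl = refl

  choose-*-!-*-! : ∀ n a b → a + b ≡ n → choose n a * (a ! * b !) ≡ n !
  choose-*-!-*-! n zero b refl = trans (*-identityˡ _) (*-identityˡ _)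
  choose-*-!-*-! (suc m) (suc a) zero e with trans (sym (+-identityʳ a)) (suc-injective e)
  ... | refl rewrite choose-diag a | choose-≡0 a (suc a) ≤-refl = trans (+-identityʳ _) (*-identityʳ _)
  choose-*-!-*-! (suc m) (suc a) (suc b) e = begin
      (choose m a + choose m (suc a)) * (suc a ! * suc b !)
    ≡⟨ solve 7 (λ x y A B a b m → (x :+ y) :* (((con 1 :+ a) :* A) :* ((con 1 :+ b) :* B)) :=
          (con 1 :+ a) :* (x :* (A :* ((con 1 :+ b) :* B))) :+ (con 1 :+ b) :* (y :* (((con 1 :+ a) :* A) :* B))) refl
         (choose m a) (choose m (suc a)) (a !) (b !) a b m ⟩
      suc a * (choose m a * (a ! * suc b !)) + suc b * (choose m (suc a) * (suc a ! * b !))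
    ≡⟨ cong₂ _+_ (cong (suc a *_) (choose-*-!-*-! m a (suc b) (suc-injective e)))
                 (cong (suc b *_) (choose-*-!-*-! m (suc a) b (trans (sym (+-suc a b)) (suc-injective e)))) ⟩
      suc a * m ! + suc b * m !
    ≡⟨ sym (*-distribʳ-+ (m !) (suc a) (suc b)) ⟩
      (suc a + suc b) * m !
    ≡⟨ cong (_* m !) e ⟩
      suc m * m ! ∎
    where
    open ≡-Reasoning
    open +-*-Solver

  choose-absorb : ∀ n k → choose (suc n) (suc k) * suc k ≡ suc n * choose n k
  choose-absorb zero zero = refl
  choose-absorb zero (suc k) = refl
  choose-absorb (suc n) zero = cong (_* 1) (choose-1 (suc (suc n)))
  choose-absorb (suc n) (suc k) = begin
      (choose (suc n) (suc k) + choose (suc n) (suc (suc k))) * suc (suc k)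
    ≡⟨ *-distribʳ-+ (suc (suc k)) (choose (suc n) (suc k)) _ ⟩
      choose (suc n) (suc k) * suc (suc k) + choose (suc n) (suc (suc k)) * suc (suc k)
    ≡⟨ cong₂ _+_ (trans (*-suc (choose (suc n) (suc k)) (suc k)) (cong (choose (suc n) (suc k) +_) (choose-absorb n k)))
                 (choose-absorb n (suc k)) ⟩
      (choose (suc n) (suc k) + suc n * choose n k) + suc n * choose n (suc k)
    ≡⟨ trans (+-assoc (choose (suc n) (suc k)) _ _)
             (cong (choose (suc n) (suc k) +_) (sym (*-distribˡ-+ (suc n) (choose n k) (choose n (suc k))))) ⟩
      suc (suc n) * choose (suc n) (suc k) ∎
    where open ≡-Reasoning

  choose-*-!≤^ : ∀ n k → choose n k * k ! ≤ n ^ k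
  choose-*-!≤^ n zero = s≤s z≤n
  choose-*-!≤^ zero (suc k) = z≤n
  choose-*-!≤^ (suc n) (suc k) = begin
      choose (suc n) (suc k) * (suc k * k !)
    ≡⟨ sym (*-assoc (choose (suc n) (suc k)) (suc k) (k !)) ⟩
      choose (suc n) (suc k) * suc k * k !
    ≡⟨ cong (_* k !) (choose-absorb n k) ⟩
      suc n * choose n k * k !
    ≡⟨ *-assoc (suc n) (choose n k) (k !) ⟩
      suc n * (choose n k * k !)
    ≤⟨ *-monoʳ-≤ (suc n) (≤-trans (choose-*-!≤^ n k) (^-monoˡ-≤ k (n≤1+n n))) ⟩
      suc n * suc n ^ k ∎
    where open ≤-Reasoning

  ^≤choose-*-! : ∀ n k c → c + k ≤ n → c ^ k ≤ choose n k * k !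
  ^≤choose-*-! n zero c _ = s≤s z≤n
  ^≤choose-*-! zero (suc k) c c+k<0 with ≤-trans (m≤n+m (suc k) c) c+k<0
  ... | ()
  ^≤choose-*-! (suc n) (suc k) c c+k≤n = begin
      c * c ^ k
    ≤⟨ *-mono-≤ (≤-trans (m≤m+n c (suc k)) c+k≤n)
                (^≤choose-*-! n k c (≤-pred (≤-trans (≤-reflexive (sym (+-suc c k))) c+k≤n))) ⟩
      suc n * (choose n k * k !)
    ≡⟨ sym (*-assoc (suc n) (choose n k) (k !)) ⟩
      suc n * choose n k * k !
    ≡⟨ cong (_* k !) (sym (choose-absorb n k)) ⟩
      choose (suc n) (suc k) * suc k * k !
    ≡⟨ *-assoc (choose (suc n) (suc k)) (suc k) (k !) ⟩
      choose (suc n) (suc k) * suc k ! ∎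
    where open ≤-Reasoning

  !≤^ : ∀ n → n ! ≤ n ^ n
  !≤^ zero = s≤s z≤n
  !≤^ (suc n) = *-monoʳ-≤ (suc n) (≤-trans (!≤^ n) (^-monoˡ-≤ n (n≤1+n n)))

  ^≤^-self-*-! : ∀ D k → 1 ≤ D → D ^ k ≤ D ^ D * k !
  ^≤^-self-*-! D zero 1≤D = ≤-trans (^-monoʳ-≤ D {{>-nonZero 1≤D}} (z≤n {D})) (≤-reflexive (sym (*-identityʳ (D ^ D))))
  ^≤^-self-*-! D (suc k) 1≤D with D ≤? suc k
  ... | yes D≤1+k = begin
      D * D ^ k
    ≤⟨ *-mono-≤ D≤1+k (^≤^-self-*-! D k 1≤D) ⟩
      suc k * (D ^ D * k !)
    ≡⟨ x∙yz≈y∙xz (suc k) (D ^ D) (k !) ⟩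
      D ^ D * (suc k * k !) ∎
    where open ≤-Reasoning
  ... | no D≰1+k = begin
      D ^ suc k
    ≤⟨ ^-monoʳ-≤ D {{>-nonZero 1≤D}} (<⇒≤ (≰⇒> D≰1+k)) ⟩
      D ^ D
    ≡⟨ sym (*-identityʳ (D ^ D)) ⟩
      D ^ D * 1
    ≤⟨ *-monoʳ-≤ (D ^ D) (1≤n! (suc k)) ⟩
      D ^ D * suc k ! ∎
    where open ≤-Reasoning

  rising : ℕ → ℕ → ℕ
  rising a zero = 1
  rising a (suc m) = a * rising (suc a) m

  rising-*-! : ∀ a m → rising (suc a) m * a ! ≡ (a + m) !
  rising-*-! a zero = trans (+-identityʳ _) (cong _! (sym (+-identityʳ a)))
  rising-*-! a (suc m) = begin
      suc a * rising (suc (suc a)) m * a !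
    ≡⟨ trans (cong (_* a !) (*-comm (suc a) (rising (suc (suc a)) m))) (*-assoc (rising (suc (suc a)) m) (suc a) (a !)) ⟩
      rising (suc (suc a)) m * suc a !
    ≡⟨ rising-*-! (suc a) m ⟩
      (suc a + m) !
    ≡⟨ cong _! (sym (+-suc a m)) ⟩
      (a + suc m) ! ∎
    where open ≡-Reasoning

  antidiagonalSum : ℕ → (ℕ → ℕ → ℕ) → ℕ
  antidiagonalSum zero F = F 0 0
  antidiagonalSum (suc n) F = F 0 (suc n) + antidiagonalSum n (λ a b → F (suc a) b)

  antidiagonalSum-cong : (n : ℕ) {F G : ℕ → ℕ → ℕ} → (∀ a b → F a b ≡ G a b) →
    antidiagonalSum n F ≡ antidiagonalSum n G
  antidiagonalSum-cong zero e = e 0 0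
  antidiagonalSum-cong (suc n) e = cong₂ _+_ (e 0 (suc n)) (antidiagonalSum-cong n (λ a b → e (suc a) b))

  antidiagonalSum-mono : (n : ℕ) {F G : ℕ → ℕ → ℕ} → (∀ a b → F a b ≤ G a b) →
    antidiagonalSum n F ≤ antidiagonalSum n G
  antidiagonalSum-mono zero e = e 0 0
  antidiagonalSum-mono (suc n) e = +-mono-≤ (e 0 (suc n)) (antidiagonalSum-mono n (λ a b → e (suc a) b))

  antidiagonalSum-+ : (n : ℕ) (F G : ℕ → ℕ → ℕ) →
    antidiagonalSum n (λ a b → F a b + G a b) ≡ antidiagonalSum n F + antidiagonalSum n G
  antidiagonalSum-+ zero F G = refl
  antidiagonalSum-+ (suc n) F G rewrite antidiagonalSum-+ n (λ a b → F (suc a) b) (λ a b → G (suc a) b) =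
    interchange (F 0 (suc n)) (G 0 (suc n)) _ _

  antidiagonalSum-shift : (n : ℕ) (F : ℕ → ℕ → ℕ) →
    antidiagonalSum n (λ a b → F a (suc b)) + F (suc n) 0 ≡ F 0 (suc n) + antidiagonalSum n (λ a b → F (suc a) b)
  antidiagonalSum-shift zero F = refl
  antidiagonalSum-shift (suc n) F = begin
      F 0 (suc (suc n)) + antidiagonalSum n (λ a b → F (suc a) (suc b)) + F (suc (suc n)) 0
    ≡⟨ +-assoc (F 0 (suc (suc n))) _ _ ⟩
      F 0 (suc (suc n)) + (antidiagonalSum n (λ a b → F (suc a) (suc b)) + F (suc (suc n)) 0)
    ≡⟨ cong (F 0 (suc (suc n)) +_) (antidiagonalSum-shift n (λ a b → F (suc a) b)) ⟩
      F 0 (suc (suc n)) + (F 1 (suc n) + antidiagonalSum n (λ a b → F (suc (suc a)) b)) ∎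
    where open ≡-Reasoning

  antidiagonalSum-zero : (n : ℕ) (G : ℕ → ℕ → ℕ) → (∀ a b → G a b ≡ 0) → antidiagonalSum n G ≡ 0
  antidiagonalSum-zero zero G e = e 0 0
  antidiagonalSum-zero (suc n) G e rewrite e 0 (suc n) = antidiagonalSum-zero n _ (λ a b → e (suc a) b)

  antidiagonalSum-head : (n : ℕ) (G : ℕ → ℕ → ℕ) → (∀ a b → G (suc a) b ≡ 0) → antidiagonalSum n G ≡ G 0 n
  antidiagonalSum-head zero G e = refl
  antidiagonalSum-head (suc n) G e = trans (cong (G 0 (suc n) +_) (antidiagonalSum-zero n _ (λ a b → e a b))) (+-identityʳ _)

module RootMasks where

  open import Defs
  open Avoidance using (increasingAt; increasing)
  open Counting
  open Binomial
  open import Data.Bool using (Bool; true; false; _∧_; _∨_; not; if_then_else_)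
  open import Data.Bool.Properties using (∧-zeroʳ; ∧-comm)
  open import Data.Nat using (ℕ; zero; suc; _+_; _*_; _<ᵇ_)
  open import Data.Nat.Properties
  open import Data.Fin using (Fin; toℕ) renaming (zero to fz)
  open import Data.Maybe using (Maybe; just; nothing; is-nothing)
  open import Data.List using (List; []; _∷_; map; allFin; _++_)
  open import Data.Vec using (Vec; lookup) renaming (_∷_ to _∷ᵛ_; [] to []ᵛ)
  open import Relation.Binary.PropositionalEquality

  booleans : List Bool
  booleans = true ∷ false ∷ []

  parentChoices : (n : ℕ) → List (Maybe (Fin n))
  parentChoices n = nothing ∷ map just (allFin n)

  -- A root mask R marks the intended roots. A parent vector fits R when exactly the marked
  -- vertices are roots and every unmarked vertex hangs below a marked vertex or a smaller one.
  module _ {n : ℕ} (R : Vec Bool n) where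

    allowedParent : Fin n → Maybe (Fin n) → Bool
    allowedParent v nothing = lookup R v
    allowedParent v (just u) = not (lookup R v) ∧ (lookup R u ∨ (toℕ u <ᵇ toℕ v))

    fits : Parents n → Bool
    fits p = allF n (λ v → allowedParent v (lookup p v))

    rootsAgree : Parents n → Fin n → Bool → Bool
    rootsAgree p v b = b ==ᴮ is-nothing (lookup p v)

    hasRoots : Parents n → Bool
    hasRoots p = allF n (λ v → rootsAgree p v (lookup R v))

    rootCount : ℕ
    rootCount = countF n (lookup R)

    nonRootCount : ℕ
    nonRootCount = countF n (λ v → not (lookup R v))

    nonRootsBelow : Fin n → ℕ
    nonRootsBelow v = countF n (λ u → not (lookup R u) ∧ (toℕ u <ᵇ toℕ v))

    private
      ==ᴮ-true⇒≡ : ∀ b c → (b ==ᴮ c) ≡ true → b ≡ c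
      ==ᴮ-true⇒≡ true true _ = refl
      ==ᴮ-true⇒≡ false false _ = refl

    hasRoots⇒root≡ : ∀ p → hasRoots p ≡ true → ∀ v → lookup R v ≡ is-nothing (lookup p v)
    hasRoots⇒root≡ p e v = ==ᴮ-true⇒≡ _ _ (allF-true n _ e v)

    fits≡hasRoots∧increasing : ∀ p → fits p ≡ hasRoots p ∧ increasing p
    fits≡hasRoots∧increasing p with hasRoots p in roots
    ... | true = trans (allF-cong n allowed≡increasing) (sym (all-tabulate n (increasingAt p) (λ v → v)))
      where
      allowed≡increasing : ∀ v → allowedParent v (lookup p v) ≡ increasingAt p v
      allowed≡increasing v with lookup p v | hasRoots⇒root≡ p roots v
      ... | nothing | Rv = Rv
      ... | just u | Rv rewrite Rv | hasRoots⇒root≡ p roots u with lookup p u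
      ...   | nothing = refl
      ...   | just _ = refl
    ... | false = trans (allF-cong n split) (trans (allF-∧ n _ _) (cong (_∧ fits p) roots))
      where
      split : ∀ v → allowedParent v (lookup p v) ≡ (rootsAgree p v (lookup R v) ∧ allowedParent v (lookup p v))
      split v with lookup p v
      ... | nothing = root-case (lookup R v)
        where
        root-case : ∀ b → b ≡ ((b ==ᴮ true) ∧ b)
        root-case true = refl
        root-case false = refl
      ... | just u = child-case (lookup R v) _
        where
        child-case : ∀ b c → (not b ∧ c) ≡ ((b ==ᴮ false) ∧ (not b ∧ c))
        child-case true c = refl
        child-case false c = refl

    hasRoots⇒rootCount≡numRoots : ∀ p → hasRoots p ≡ true → rootCount ≡ numRoots p
    hasRoots⇒rootCount≡numRoots p e = trans (countF-cong n (hasRoots⇒root≡ p e))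
      (sym (trans (length-filter (λ v → is-nothing (lookup p v)) (allFin n)) (count-tabulate n _ (λ v → v))))

    count-allowedParent : ∀ v → count (allowedParent v) (parentChoices n) ≡
      (if lookup R v then 1 else rootCount + nonRootsBelow v)
    count-allowedParent v rewrite count-map (allowedParent v) just (allFin n)
                                | count-tabulate n (λ u → allowedParent v (just u)) (λ u → u) with lookup R v
    ... | true = cong suc (countF-false n)
    ... | false = countF-∨ n (lookup R) (λ u → toℕ u <ᵇ toℕ v)

  count-hasRoots : {n : ℕ} (p : Parents n) → count (λ R → hasRoots R p) (allVecs booleans n) ≡ 1
  count-hasRoots {n} p = trans (count-allF booleans n (λ v b → b ==ᴮ is-nothing (lookup p v)))
                               (trans (prodF-cong n one-choice) (prodF-1 n))
    where
    one-choice : ∀ v → count (λ b → b ==ᴮ is-nothing (lookup p v)) booleans ≡ 1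
    one-choice v with is-nothing (lookup p v)
    ... | true = refl
    ... | false = refl

  -- Each parent vector has exactly one root mask, so summing over masks only reindexes a count.
  sumOver-masks : {n : ℕ} (M : Vec Bool n → Parents n → Bool) (c : Parents n → Bool) →
    (∀ R p → M R p ≡ hasRoots R p ∧ c p) →
    (ps : List (Parents n)) → sumOver (λ R → count (M R) ps) (allVecs booleans n) ≡ count c ps
  sumOver-masks {n} M c M≡ ps = begin
      sumOver (λ R → count (M R) ps) masks
    ≡⟨ count-swap M ps masks ⟩
      sumOver (λ p → count (λ R → M R p) masks) ps
    ≡⟨ sumOver-cong ps (λ p → trans (count-cong masks (λ R → trans (M≡ R p) (∧-comm (hasRoots R p) (c p))))
                                     (trans (count-∧ˡ (c p) (λ R → hasRoots R p) masks)
                                            (cong (indicator (c p) *_) (count-hasRoots p)))) ⟩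
      sumOver (λ p → indicator (c p) * 1) ps
    ≡⟨ sumOver-indicator-* c 1 ps ⟩
      count c ps * 1
    ≡⟨ *-identityʳ _ ⟩
      count c ps ∎
    where
    open ≡-Reasoning
    masks = allVecs booleans n

  private
    prodF-allowed≡rising : (n : ℕ) (R : Vec Bool n) (a i : ℕ) →
      prodF n (λ v → if lookup R v then 1 else a + (i + nonRootsBelow R v)) ≡ rising (a + i) (nonRootCount R)
    prodF-allowed≡rising zero []ᵛ a i = refl
    prodF-allowed≡rising (suc n) (true ∷ᵛ R) a i = trans (+-identityʳ _) (prodF-allowed≡rising n R a i)
    prodF-allowed≡rising (suc n) (false ∷ᵛ R) a i = begin
        (a + (i + nonRootsBelow (false ∷ᵛ R) fz)) * prodF n (λ v → if lookup R v then 1 else a + (i + suc (nonRootsBelow R v)))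
      ≡⟨ cong₂ _*_ (cong (λ x → a + (i + x)) nothing-below-first) (prodF-cong n shift) ⟩
        (a + (i + 0)) * prodF n (λ v → if lookup R v then 1 else a + (suc i + nonRootsBelow R v))
      ≡⟨ cong₂ _*_ (cong (a +_) (+-identityʳ i)) (prodF-allowed≡rising n R a (suc i)) ⟩
        (a + i) * rising (a + suc i) (nonRootCount R)
      ≡⟨ cong (λ x → (a + i) * rising x (nonRootCount R)) (+-suc a i) ⟩
        (a + i) * rising (suc (a + i)) (nonRootCount R) ∎
      where
      open ≡-Reasoning
      nothing-below-first : nonRootsBelow (false ∷ᵛ R) fz ≡ 0
      nothing-below-first = trans (countF-cong (suc n) (λ u → ∧-zeroʳ (not (lookup (false ∷ᵛ R) u)))) (countF-false (suc n))
      shift : ∀ v → (if lookup R v then 1 else a + (i + suc (nonRootsBelow R v))) ≡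
                    (if lookup R v then 1 else a + (suc i + nonRootsBelow R v))
      shift v with lookup R v
      ... | true = refl
      ... | false = cong (a +_) (+-suc i _)

  -- The j-th unmarked vertex (in label order) may hang below any of the a marked ones or below
  -- one of the j ∸ 1 earlier unmarked ones.
  count-fits : {n : ℕ} (R : Vec Bool n) → count (fits R) (allParents n) ≡ rising (rootCount R) (nonRootCount R)
  count-fits {n} R = begin
      count (fits R) (allParents n)
    ≡⟨ count-allF (parentChoices n) n (allowedParent R) ⟩
      prodF n (λ v → count (allowedParent R v) (parentChoices n))
    ≡⟨ prodF-cong n (count-allowedParent R) ⟩
      prodF n (λ v → if lookup R v then 1 else rootCount R + nonRootsBelow R v)
    ≡⟨ prodF-allowed≡rising n R (rootCount R) 0 ⟩
      rising (rootCount R + 0) (nonRootCount R)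
    ≡⟨ cong (λ x → rising x (nonRootCount R)) (+-identityʳ _) ⟩
      rising (rootCount R) (nonRootCount R) ∎
    where open ≡-Reasoning

  sumOver-masks-by-size : (n : ℕ) (H : ℕ → ℕ → ℕ) →
    sumOver (λ R → H (rootCount R) (nonRootCount R)) (allVecs booleans n) ≡ antidiagonalSum n (λ a b → choose n a * H a b)
  sumOver-masks-by-size zero H = trans (+-identityʳ _) (sym (+-identityʳ _))
  sumOver-masks-by-size (suc n) H = begin
      sumOver (λ R → H (rootCount R) (nonRootCount R)) (map (true ∷ᵛ_) masks ++ (map (false ∷ᵛ_) masks ++ []))
    ≡⟨ trans (sumOver-++ _ (map (true ∷ᵛ_) masks) _)
             (cong₂ _+_ (sumOver-map _ _ masks)
                        (trans (sumOver-++ _ (map (false ∷ᵛ_) masks) []) (cong₂ _+_ (sumOver-map _ _ masks) refl))) ⟩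
      sumOver (λ R → H (suc (rootCount R)) (nonRootCount R)) masks
        + (sumOver (λ R → H (rootCount R) (suc (nonRootCount R))) masks + 0)
    ≡⟨ cong₂ _+_ (sumOver-masks-by-size n (λ a b → H (suc a) b))
                 (trans (+-identityʳ _) (sumOver-masks-by-size n (λ a b → H a (suc b)))) ⟩
      marked + unmarked
    ≡⟨ cong (marked +_) unmarked≡ ⟩
      marked + (H 0 (suc n) + unmarked′)
    ≡⟨ trans (sym (+-assoc marked _ unmarked′)) (trans (cong (_+ unmarked′) (+-comm marked _)) (+-assoc _ marked unmarked′)) ⟩
      H 0 (suc n) + (marked + unmarked′)
    ≡⟨ cong₂ _+_ (sym (+-identityʳ _)) (sym (antidiagonalSum-+ n _ _)) ⟩
      1 * H 0 (suc n) + antidiagonalSum n (λ a b → choose n a * H (suc a) b + choose n (suc a) * H (suc a) b)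
    ≡⟨ cong (1 * H 0 (suc n) +_)
            (antidiagonalSum-cong n (λ a b → sym (*-distribʳ-+ (H (suc a) b) (choose n a) (choose n (suc a))))) ⟩
      antidiagonalSum (suc n) (λ a b → choose (suc n) a * H a b) ∎
    where
    open ≡-Reasoning
    masks = allVecs booleans n
    marked = antidiagonalSum n (λ a b → choose n a * H (suc a) b)
    unmarked = antidiagonalSum n (λ a b → choose n a * H a (suc b))
    unmarked′ = antidiagonalSum n (λ a b → choose n (suc a) * H (suc a) b)
    unmarked≡ : unmarked ≡ H 0 (suc n) + unmarked′
    unmarked≡ = begin
        unmarked
      ≡⟨ sym (+-identityʳ unmarked) ⟩
        unmarked + 0
      ≡⟨ cong (unmarked +_) (cong (_* H (suc n) 0) (sym (choose-≡0 n (suc n) ≤-refl))) ⟩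
        unmarked + choose n (suc n) * H (suc n) 0
      ≡⟨ antidiagonalSum-shift n (λ a b → choose n a * H a b) ⟩
        1 * H 0 (suc n) + unmarked′
      ≡⟨ cong (_+ unmarked′) (+-identityʳ _) ⟩
        H 0 (suc n) + unmarked′ ∎

module ClosedForm where

  open import Defs
  open Avoidance using (increasing; forest∧avoids-S₀≡increasing)
  open Counting
  open Binomial
  open RootMasks
  open import Data.Bool using (Bool; true; false; _∧_)
  open import Data.Bool.Properties using (∧-assoc; ∧-comm; ∧-zeroʳ)
  open import Data.Vec using (Vec)
  open import Data.Nat using (ℕ; suc; _+_; _*_; _!; _≥_; _≤_; _≡ᵇ_; z≤n)
  open import Data.Nat.Properties
  open import Relation.Binary.PropositionalEquality

  f-S₀≡ : (n : ℕ) → f S₀ n ≡ antidiagonalSum n (λ a b → choose n a * rising a b)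
  f-S₀≡ n = begin
      f S₀ n
    ≡⟨ length-filter (λ p → isForest p ∧ avoids p S₀) (allParents n) ⟩
      count (λ p → isForest p ∧ avoids p S₀) (allParents n)
    ≡⟨ count-cong (allParents n) forest∧avoids-S₀≡increasing ⟩
      count increasing (allParents n)
    ≡⟨ sym (sumOver-masks fits increasing fits≡hasRoots∧increasing (allParents n)) ⟩
      sumOver (λ R → count (fits R) (allParents n)) (allVecs booleans n)
    ≡⟨ sumOver-cong (allVecs booleans n) count-fits ⟩
      sumOver (λ R → rising (rootCount R) (nonRootCount R)) (allVecs booleans n)
    ≡⟨ sumOver-masks-by-size n rising ⟩
      antidiagonalSum n (λ a b → choose n a * rising a b) ∎
    where open ≡-Reasoning

  t-S₀≡ : (n : ℕ) → t S₀ n ≡ antidiagonalSum n (λ a b → choose n a * (indicator (a ≡ᵇ 1) * rising a b))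
  t-S₀≡ n = begin
      t S₀ n
    ≡⟨ length-filter (λ p → isTree p ∧ avoids p S₀) (allParents n) ⟩
      count (λ p → isTree p ∧ avoids p S₀) (allParents n)
    ≡⟨ count-cong (allParents n) tree∧avoids≡ ⟩
      count oneRoot∧increasing (allParents n)
    ≡⟨ sym (sumOver-masks fitsOneRoot oneRoot∧increasing fitsOneRoot≡ (allParents n)) ⟩
      sumOver (λ R → count (fitsOneRoot R) (allParents n)) (allVecs booleans n)
    ≡⟨ sumOver-cong (allVecs booleans n) (λ R → trans (count-∧ˡ (rootCount R ≡ᵇ 1) (fits R) (allParents n))
                                                      (cong (indicator (rootCount R ≡ᵇ 1) *_) (count-fits R))) ⟩
      sumOver (λ R → indicator (rootCount R ≡ᵇ 1) * rising (rootCount R) (nonRootCount R)) (allVecs booleans n)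
    ≡⟨ sumOver-masks-by-size n (λ a b → indicator (a ≡ᵇ 1) * rising a b) ⟩
      antidiagonalSum n (λ a b → choose n a * (indicator (a ≡ᵇ 1) * rising a b)) ∎
    where
    open ≡-Reasoning
    oneRoot∧increasing : Parents n → Bool
    oneRoot∧increasing p = (numRoots p ≡ᵇ 1) ∧ increasing p
    fitsOneRoot : Vec Bool n → Parents n → Bool
    fitsOneRoot R p = (rootCount R ≡ᵇ 1) ∧ fits R p
    tree∧avoids≡ : (p : Parents n) → (isTree p ∧ avoids p S₀) ≡ oneRoot∧increasing p
    tree∧avoids≡ p = begin
        (isForest p ∧ (numRoots p ≡ᵇ 1)) ∧ avoids p S₀
      ≡⟨ cong (_∧ avoids p S₀) (∧-comm (isForest p) _) ⟩
        ((numRoots p ≡ᵇ 1) ∧ isForest p) ∧ avoids p S₀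
      ≡⟨ ∧-assoc (numRoots p ≡ᵇ 1) _ _ ⟩
        (numRoots p ≡ᵇ 1) ∧ (isForest p ∧ avoids p S₀)
      ≡⟨ cong ((numRoots p ≡ᵇ 1) ∧_) (forest∧avoids-S₀≡increasing p) ⟩
        oneRoot∧increasing p ∎
    fitsOneRoot≡ : ∀ R p → fitsOneRoot R p ≡ hasRoots R p ∧ oneRoot∧increasing p
    fitsOneRoot≡ R p rewrite fits≡hasRoots∧increasing R p with hasRoots R p in roots
    ... | true rewrite hasRoots⇒rootCount≡numRoots R p roots = refl
    ... | false = ∧-zeroʳ _

  t-S₀≡! : (n : ℕ) → n ≥ 1 → t S₀ n ≡ n !
  t-S₀≡! (suc m) _ = begin
      t S₀ (suc m)
    ≡⟨ t-S₀≡ (suc m) ⟩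
      0 + antidiagonalSum m (λ a b → choose (suc m) (suc a) * (indicator (suc a ≡ᵇ 1) * rising (suc a) b))
    ≡⟨ antidiagonalSum-head m _ (λ a b → *-zeroʳ (choose (suc m) (suc (suc a)))) ⟩
      choose (suc m) 1 * (1 * rising 1 m)
    ≡⟨ cong₂ _*_ (cong suc (choose-1 m)) (trans (+-identityʳ _) (trans (sym (*-identityʳ _)) (rising-*-! 0 m))) ⟩
      suc m * m ! ∎
    where open ≡-Reasoning

  t-S₀≤f-S₀ : ∀ n → t S₀ n ≤ f S₀ n
  t-S₀≤f-S₀ n = begin
      t S₀ n
    ≡⟨ t-S₀≡ n ⟩
      antidiagonalSum n (λ a b → choose n a * (indicator (a ≡ᵇ 1) * rising a b))
    ≤⟨ antidiagonalSum-mono n (λ a b → *-monoʳ-≤ (choose n a) (indicator-*≤ (a ≡ᵇ 1) (rising a b))) ⟩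
      antidiagonalSum n (λ a b → choose n a * rising a b)
    ≡⟨ f-S₀≡ n ⟨
      f S₀ n ∎
    where
    open ≤-Reasoning
    indicator-*≤ : ∀ b x → indicator b * x ≤ x
    indicator-*≤ true x = ≤-reflexive (*-identityˡ x)
    indicator-*≤ false x = z≤n

module Fractions where

  open import Defs using (fromℕQ)
  open import Data.Nat using (ℕ; suc; NonZero)
  import Data.Nat as ℕ
  import Data.Nat.Properties as ℕ
  open import Data.Integer using (+_; -[1+_])
  import Data.Integer as ℤ
  import Data.Integer.Properties as ℤ
  open import Data.Rational using (ℚ; mkℚ; _/_; _+_; _*_; 0ℚ; 1ℚ; _≤_; _<_; *≤*; toℚᵘ)
  import Data.Rational.Properties as ℚ
  open import Data.Rational.Unnormalised using (mkℚᵘ; *≡*; *≤*; *<*) renaming (_≃_ to _≃ᵘ_)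
  import Data.Rational.Unnormalised as ℚᵘ
  import Data.Rational.Unnormalised.Properties as ℚᵘ
  open import Data.Product using (Σ; _,_)
  open import Data.Empty using (⊥-elim)
  open import Relation.Nullary using (yes; no)
  open import Relation.Binary.PropositionalEquality

  Fr : (a d : ℕ) .{{_ : NonZero d}} → ℚ
  Fr a d = (+ a) / d

  private
    toℚᵘ-Fr : ∀ a d .{{_ : NonZero d}} → toℚᵘ (Fr a d) ≃ᵘ ((+ a) ℚᵘ./ d)
    toℚᵘ-Fr a (suc d) = ℚ.toℚᵘ-fromℚᵘ (mkℚᵘ (+ a) d)

  Fr-cong : ∀ a d b e .{{_ : NonZero d}} .{{_ : NonZero e}} → a ℕ.* e ≡ b ℕ.* d → Fr a d ≡ Fr b e
  Fr-cong a (suc d) b (suc e) ae≡bd = ℚ.toℚᵘ-injective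
    (ℚᵘ.≃-trans (toℚᵘ-Fr a (suc d)) (ℚᵘ.≃-trans (*≡* cross) (ℚᵘ.≃-sym (toℚᵘ-Fr b (suc e)))))
    where
    cross : (+ a) ℤ.* (+ suc e) ≡ (+ b) ℤ.* (+ suc d)
    cross = trans (sym (ℤ.pos-* a (suc e))) (trans (cong +_ ae≡bd) (ℤ.pos-* b (suc d)))

  Fr-+ : ∀ a d b e .{{_ : NonZero d}} .{{_ : NonZero e}} →
    Fr a d + Fr b e ≡ Fr (a ℕ.* e ℕ.+ b ℕ.* d) (d ℕ.* e) {{ℕ.m*n≢0 d e}}
  Fr-+ a (suc d) b (suc e) = ℚ.toℚᵘ-injective
    (ℚᵘ.≃-trans (ℚ.toℚᵘ-homo-+ (Fr a (suc d)) (Fr b (suc e)))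
    (ℚᵘ.≃-trans (ℚᵘ.+-cong (toℚᵘ-Fr a (suc d)) (toℚᵘ-Fr b (suc e)))
    (ℚᵘ.≃-trans (ℚᵘ.≃-reflexive (cong (λ z → z ℚᵘ./ (suc d ℕ.* suc e)) numerator))
    (ℚᵘ.≃-sym (toℚᵘ-Fr (a ℕ.* suc e ℕ.+ b ℕ.* suc d) (suc d ℕ.* suc e))))))
    where
    numerator : (+ a) ℤ.* (+ suc e) ℤ.+ (+ b) ℤ.* (+ suc d) ≡ + (a ℕ.* suc e ℕ.+ b ℕ.* suc d)
    numerator = trans (cong₂ ℤ._+_ (sym (ℤ.pos-* a (suc e))) (sym (ℤ.pos-* b (suc d))))
                      (sym (ℤ.pos-+ (a ℕ.* suc e) (b ℕ.* suc d)))

  Fr-* : ∀ a d b e .{{_ : NonZero d}} .{{_ : NonZero e}} → Fr a d * Fr b e ≡ Fr (a ℕ.* b) (d ℕ.* e) {{ℕ.m*n≢0 d e}}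
  Fr-* a (suc d) b (suc e) = ℚ.toℚᵘ-injective
    (ℚᵘ.≃-trans (ℚ.toℚᵘ-homo-* (Fr a (suc d)) (Fr b (suc e)))
    (ℚᵘ.≃-trans (ℚᵘ.*-cong (toℚᵘ-Fr a (suc d)) (toℚᵘ-Fr b (suc e)))
    (ℚᵘ.≃-trans (ℚᵘ.≃-reflexive (cong (λ z → z ℚᵘ./ (suc d ℕ.* suc e)) (sym (ℤ.pos-* a b))))
    (ℚᵘ.≃-sym (toℚᵘ-Fr (a ℕ.* b) (suc d ℕ.* suc e))))))

  Fr-≤ : ∀ a d b e .{{_ : NonZero d}} .{{_ : NonZero e}} → a ℕ.* e ℕ.≤ b ℕ.* d → Fr a d ≤ Fr b e
  Fr-≤ a (suc d) b (suc e) ae≤bd = ℚ.toℚᵘ-cancel-≤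
    (ℚᵘ.≤-respʳ-≃ (ℚᵘ.≃-sym (toℚᵘ-Fr b (suc e))) (ℚᵘ.≤-respˡ-≃ (ℚᵘ.≃-sym (toℚᵘ-Fr a (suc d)))
       (*≤* (subst₂ ℤ._≤_ (ℤ.pos-* a (suc e)) (ℤ.pos-* b (suc d)) (ℤ.+≤+ ae≤bd)))))

  Fr-< : ∀ a d b e .{{_ : NonZero d}} .{{_ : NonZero e}} → a ℕ.* e ℕ.< b ℕ.* d → Fr a d < Fr b e
  Fr-< a (suc d) b (suc e) ae<bd = ℚ.toℚᵘ-cancel-<
    (ℚᵘ.<-respʳ-≃ (ℚᵘ.≃-sym (toℚᵘ-Fr b (suc e))) (ℚᵘ.<-respˡ-≃ (ℚᵘ.≃-sym (toℚᵘ-Fr a (suc d)))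
       (*<* (subst₂ ℤ._<_ (ℤ.pos-* a (suc e)) (ℤ.pos-* b (suc d)) (ℤ.+<+ ae<bd)))))

  Fr-<⁻¹ : ∀ a d b e .{{_ : NonZero d}} .{{_ : NonZero e}} → Fr a d < Fr b e → a ℕ.* e ℕ.< b ℕ.* d
  Fr-<⁻¹ a d b e lt with a ℕ.* e ℕ.<? b ℕ.* d
  ... | yes ae<bd = ae<bd
  ... | no ae≮bd = ⊥-elim (ℚ.<-irrefl refl (ℚ.<-≤-trans lt (Fr-≤ b e a d (ℕ.≮⇒≥ ae≮bd))))

  nonNegative⇒Fr : ∀ x → 0ℚ ≤ x → Σ ℕ λ a → Σ ℕ λ d → x ≡ Fr a (suc d)
  nonNegative⇒Fr x@(mkℚ (+ a) d _) _ = a , d , sym (ℚ.↥p/↧p≡p x)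
  nonNegative⇒Fr (mkℚ -[1+ n ] d _) (*≤* ())

  0≤Fr : ∀ a d .{{_ : NonZero d}} → 0ℚ ≤ Fr a d
  0≤Fr a d = Fr-≤ 0 1 a d ℕ.z≤n

  fromℕQ-+ : ∀ a b → fromℕQ a + fromℕQ b ≡ fromℕQ (a ℕ.+ b)
  fromℕQ-+ a b = trans (Fr-+ a 1 b 1) (cong (λ z → Fr z 1) (cong₂ ℕ._+_ (ℕ.*-identityʳ a) (ℕ.*-identityʳ b)))

  fromℕQ-* : ∀ a b → fromℕQ a * fromℕQ b ≡ fromℕQ (a ℕ.* b)
  fromℕQ-* a b = Fr-* a 1 b 1

  fromℕQ-suc : ∀ n → fromℕQ (suc n) ≡ fromℕQ n + 1ℚ
  fromℕQ-suc n = sym (trans (fromℕQ-+ n 1) (cong fromℕQ (ℕ.+-comm n 1)))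

  0≤fromℕQ : ∀ a → 0ℚ ≤ fromℕQ a
  0≤fromℕQ a = 0≤Fr a 1

  fromℕQ-mono-≤ : ∀ {a b} → a ℕ.≤ b → fromℕQ a ≤ fromℕQ b
  fromℕQ-mono-≤ {a} {b} a≤b = Fr-≤ a 1 b 1 (ℕ.*-monoˡ-≤ 1 a≤b)

  fromℕQ-mono-< : ∀ {a b} → a ℕ.< b → fromℕQ a < fromℕQ b
  fromℕQ-mono-< {a} {b} a<b = Fr-< a 1 b 1 (ℕ.*-monoˡ-< 1 a<b)

  0≤1 : 0ℚ ≤ 1ℚ
  0≤1 = fromℕQ-mono-≤ {0} {1} ℕ.z≤n

  0<1 : 0ℚ < 1ℚ
  0<1 = fromℕQ-mono-< {0} {1} (ℕ.s≤s ℕ.z≤n)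

module RationalFacts where

  open import Defs using (sumBelow; powQ; fromℕQ)
  open Binomial using (choose; choose-≡0)
  open Fractions
  open import Data.Nat using (ℕ; zero; suc; NonZero; _^_)
  import Data.Nat as ℕ
  import Data.Nat.Properties as ℕ
  open import Data.Rational using (ℚ; _+_; _*_; 0ℚ; 1ℚ; _≤_; _<_; positive; nonNegative)
  import Data.Rational.Properties as ℚ
  open import Algebra.Bundles using (CommutativeMonoid)
  open import Algebra.Properties.CommutativeSemigroup (CommutativeMonoid.commutativeSemigroup ℚ.*-1-commutativeMonoid)
    using (x∙yz≈y∙xz) renaming (interchange to *-interchange)
  open import Algebra.Properties.CommutativeSemigroup (CommutativeMonoid.commutativeSemigroup ℚ.+-0-commutativeMonoid)
    using () renaming (interchange to +-interchange)
  open import Relation.Binary.PropositionalEquality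

  *-monoʳ-≤-0≤ : ∀ {r a b} → 0ℚ ≤ r → a ≤ b → r * a ≤ r * b
  *-monoʳ-≤-0≤ {r} 0≤r = ℚ.*-monoˡ-≤-nonNeg r {{nonNegative 0≤r}}

  *-monoˡ-≤-0≤ : ∀ {r a b} → 0ℚ ≤ r → a ≤ b → a * r ≤ b * r
  *-monoˡ-≤-0≤ {r} 0≤r = ℚ.*-monoʳ-≤-nonNeg r {{nonNegative 0≤r}}

  *-mono-≤-0≤ : ∀ {a b c d} → 0ℚ ≤ a → 0ℚ ≤ c → a ≤ b → c ≤ d → a * c ≤ b * d
  *-mono-≤-0≤ 0≤a 0≤c a≤b c≤d = ℚ.≤-trans (*-monoˡ-≤-0≤ 0≤c a≤b) (*-monoʳ-≤-0≤ (ℚ.≤-trans 0≤a a≤b) c≤d)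

  *-monoʳ-<-0< : ∀ {r a b} → 0ℚ < r → a < b → r * a < r * b
  *-monoʳ-<-0< {r} 0<r = ℚ.*-monoʳ-<-pos r {{positive 0<r}}

  *-monoˡ-<-0< : ∀ {r a b} → 0ℚ < r → a < b → a * r < b * r
  *-monoˡ-<-0< {r} 0<r = ℚ.*-monoˡ-<-pos r {{positive 0<r}}

  0≤* : ∀ {a b} → 0ℚ ≤ a → 0ℚ ≤ b → 0ℚ ≤ a * b
  0≤* {a} {b} 0≤a 0≤b = subst (_≤ a * b) (ℚ.*-zeroʳ a) (*-monoʳ-≤-0≤ 0≤a 0≤b)

  0<* : ∀ {a b} → 0ℚ < a → 0ℚ < b → 0ℚ < a * b
  0<* {a} {b} 0<a 0<b = subst (_< a * b) (ℚ.*-zeroʳ a) (*-monoʳ-<-0< 0<a 0<b)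

  *-cancelʳ-<-0≤ : ∀ {r a b} → 0ℚ ≤ r → a * r < b * r → a < b
  *-cancelʳ-<-0≤ {r} 0≤r = ℚ.*-cancelʳ-<-nonNeg r {{nonNegative 0≤r}}

  x≤x+y : ∀ {x y} → 0ℚ ≤ y → x ≤ x + y
  x≤x+y {x} 0≤y = ℚ.≤-trans (ℚ.≤-reflexive (sym (ℚ.+-identityʳ x))) (ℚ.+-monoʳ-≤ x 0≤y)

  powQ-*-distrib : ∀ a b k → powQ (a * b) k ≡ powQ a k * powQ b k
  powQ-*-distrib a b zero = refl
  powQ-*-distrib a b (suc k) = trans (cong ((a * b) *_) (powQ-*-distrib a b k)) (*-interchange a b (powQ a k) (powQ b k))

  powQ-fromℕQ : ∀ a k → powQ (fromℕQ a) k ≡ fromℕQ (a ^ k)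
  powQ-fromℕQ a zero = refl
  powQ-fromℕQ a (suc k) = trans (cong (fromℕQ a *_) (powQ-fromℕQ a k)) (fromℕQ-* a (a ^ k))

  powQ-1/d : ∀ d k .{{_ : NonZero d}} → powQ (Fr 1 d) k ≡ Fr 1 (d ^ k) {{ℕ.m^n≢0 d k}}
  powQ-1/d d zero = refl
  powQ-1/d d (suc k) {{d≢0}} = trans (cong (Fr 1 d *_) (powQ-1/d d k)) (Fr-* 1 d 1 (d ^ k) {{d≢0}} {{ℕ.m^n≢0 d k}})

  powQ-+ : ∀ a j k → powQ a (j ℕ.+ k) ≡ powQ a j * powQ a k
  powQ-+ a zero k = sym (ℚ.*-identityˡ _)
  powQ-+ a (suc j) k = trans (cong (a *_) (powQ-+ a j k)) (sym (ℚ.*-assoc a _ _))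

  0≤powQ : ∀ {a} k → 0ℚ ≤ a → 0ℚ ≤ powQ a k
  0≤powQ zero _ = 0≤1
  0≤powQ (suc k) 0≤a = 0≤* 0≤a (0≤powQ k 0≤a)

  0<powQ : ∀ {a} k → 0ℚ < a → 0ℚ < powQ a k
  0<powQ zero _ = 0<1
  0<powQ (suc k) 0<a = 0<* 0<a (0<powQ k 0<a)

  powQ-≤1 : ∀ {r} k → 0ℚ ≤ r → r ≤ 1ℚ → powQ r k ≤ 1ℚ
  powQ-≤1 zero _ _ = ℚ.≤-refl
  powQ-≤1 {r} (suc k) 0≤r r≤1 =
    ℚ.≤-trans (*-monoʳ-≤-0≤ 0≤r (powQ-≤1 k 0≤r r≤1)) (ℚ.≤-trans (ℚ.≤-reflexive (ℚ.*-identityʳ r)) r≤1)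

  sumBelow-suc : ∀ m (g : ℕ → ℚ) → sumBelow (suc m) g ≡ g 0 + sumBelow m (λ i → g (suc i))
  sumBelow-suc zero g = trans (ℚ.+-identityˡ (g 0)) (sym (ℚ.+-identityʳ (g 0)))
  sumBelow-suc (suc m) g = trans (cong (_+ g (suc m)) (sumBelow-suc m g)) (ℚ.+-assoc (g 0) _ _)

  sumBelow-cong : ∀ m {g h : ℕ → ℚ} → (∀ i → i ℕ.< m → g i ≡ h i) → sumBelow m g ≡ sumBelow m h
  sumBelow-cong zero e = refl
  sumBelow-cong (suc m) e = cong₂ _+_ (sumBelow-cong m (λ i i<m → e i (ℕ.m<n⇒m<1+n i<m))) (e m ℕ.≤-refl)

  sumBelow-mono-≤ : ∀ m {g h : ℕ → ℚ} → (∀ i → i ℕ.< m → g i ≤ h i) → sumBelow m g ≤ sumBelow m h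
  sumBelow-mono-≤ zero e = ℚ.≤-refl
  sumBelow-mono-≤ (suc m) e = ℚ.+-mono-≤ (sumBelow-mono-≤ m (λ i i<m → e i (ℕ.m<n⇒m<1+n i<m))) (e m ℕ.≤-refl)

  0≤sumBelow : ∀ m {g : ℕ → ℚ} → (∀ i → i ℕ.< m → 0ℚ ≤ g i) → 0ℚ ≤ sumBelow m g
  0≤sumBelow zero e = ℚ.≤-refl
  0≤sumBelow (suc m) e = ℚ.≤-trans (ℚ.≤-reflexive (sym (ℚ.+-identityʳ 0ℚ)))
    (ℚ.+-mono-≤ (0≤sumBelow m (λ i i<m → e i (ℕ.m<n⇒m<1+n i<m))) (e m ℕ.≤-refl))

  sumBelow-≤-+ : ∀ m j {g : ℕ → ℚ} → (∀ i → 0ℚ ≤ g i) → sumBelow m g ≤ sumBelow (m ℕ.+ j) g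
  sumBelow-≤-+ m zero {g} _ = ℚ.≤-reflexive (cong (λ z → sumBelow z g) (sym (ℕ.+-identityʳ m)))
  sumBelow-≤-+ m (suc j) {g} 0≤g = ℚ.≤-trans (sumBelow-≤-+ m j 0≤g)
    (ℚ.≤-trans (x≤x+y (0≤g (m ℕ.+ j))) (ℚ.≤-reflexive (cong (λ z → sumBelow z g) (sym (ℕ.+-suc m j)))))

  *-sumBelow : ∀ m c (g : ℕ → ℚ) → c * sumBelow m g ≡ sumBelow m (λ i → c * g i)
  *-sumBelow zero c g = ℚ.*-zeroʳ c
  *-sumBelow (suc m) c g = trans (ℚ.*-distribˡ-+ c _ _) (cong (_+ c * g m) (*-sumBelow m c g))

  sumBelow-+ : ∀ m (g h : ℕ → ℚ) → sumBelow m (λ i → g i + h i) ≡ sumBelow m g + sumBelow m h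
  sumBelow-+ zero g h = refl
  sumBelow-+ (suc m) g h =
    trans (cong (_+ (g m + h m)) (sumBelow-+ m g h)) (+-interchange (sumBelow m g) (sumBelow m h) (g m) (h m))

  binomialSum : ℚ → ℕ → ℚ
  binomialSum x n = sumBelow (suc n) (λ k → fromℕQ (choose n k) * powQ x k)

  powQ-1+x≡binomialSum : ∀ x n → powQ (1ℚ + x) n ≡ binomialSum x n
  powQ-1+x≡binomialSum x zero = refl
  powQ-1+x≡binomialSum x (suc n) = begin
      (1ℚ + x) * powQ (1ℚ + x) n
    ≡⟨ cong ((1ℚ + x) *_) (powQ-1+x≡binomialSum x n) ⟩
      (1ℚ + x) * B
    ≡⟨ trans (ℚ.*-distribʳ-+ B 1ℚ x) (trans (cong (_+ x * B) (ℚ.*-identityˡ B)) (ℚ.+-comm B (x * B))) ⟩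
      x * B + B
    ≡⟨ cong₂ _+_ (*-sumBelow (suc n) x term) (trans (sumBelow-suc n term) (cong (1ℚ +_) shifted-extend)) ⟩
      S + (1ℚ + V)
    ≡⟨ trans (sym (ℚ.+-assoc S 1ℚ V)) (trans (cong (_+ V) (ℚ.+-comm S 1ℚ)) (ℚ.+-assoc 1ℚ S V)) ⟩
      1ℚ + (S + V)
    ≡⟨ cong (1ℚ +_) (sym (sumBelow-+ (suc n) (λ k → x * term k) shifted)) ⟩
      1ℚ + sumBelow (suc n) (λ k → x * term k + shifted k)
    ≡⟨ cong (1ℚ +_) (sumBelow-cong (suc n) (λ k _ → pascal k)) ⟩
      1ℚ + sumBelow (suc n) (λ k → fromℕQ (choose (suc n) (suc k)) * powQ x (suc k))
    ≡⟨ sym (sumBelow-suc (suc n) (λ k → fromℕQ (choose (suc n) k) * powQ x k)) ⟩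
      binomialSum x (suc n) ∎
    where
    open ≡-Reasoning
    term shifted : ℕ → ℚ
    term k = fromℕQ (choose n k) * powQ x k
    shifted k = term (suc k)
    B = binomialSum x n
    S = sumBelow (suc n) (λ k → x * term k)
    V = sumBelow (suc n) shifted
    shifted-extend : sumBelow n shifted ≡ V
    shifted-extend = sym (trans (cong (sumBelow n shifted +_) last≡0) (ℚ.+-identityʳ (sumBelow n shifted)))
      where
      last≡0 : shifted n ≡ 0ℚ
      last≡0 = trans (cong (λ z → fromℕQ z * powQ x (suc n)) (choose-≡0 n (suc n) ℕ.≤-refl)) (ℚ.*-zeroˡ (powQ x (suc n)))
    pascal : ∀ k → x * term k + shifted k ≡ fromℕQ (choose (suc n) (suc k)) * powQ x (suc k)
    pascal k = begin
        x * (fromℕQ (choose n k) * powQ x k) + shifted k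
      ≡⟨ cong (_+ shifted k) (x∙yz≈y∙xz x (fromℕQ (choose n k)) (powQ x k)) ⟩
        fromℕQ (choose n k) * powQ x (suc k) + fromℕQ (choose n (suc k)) * powQ x (suc k)
      ≡⟨ sym (ℚ.*-distribʳ-+ (powQ x (suc k)) (fromℕQ (choose n k)) (fromℕQ (choose n (suc k)))) ⟩
        (fromℕQ (choose n k) + fromℕQ (choose n (suc k))) * powQ x (suc k)
      ≡⟨ cong (_* powQ x (suc k)) (fromℕQ-+ (choose n k) (choose n (suc k))) ⟩
        fromℕQ (choose (suc n) (suc k)) * powQ x (suc k) ∎

module Series where

  open import Defs
  open Binomial
  open ClosedForm using (f-S₀≡; t-S₀≡!)
  open Fractions
  open RationalFacts using (sumBelow-cong)
  open import Data.Bool using (if_then_else_)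
  open import Data.Nat using (ℕ; zero; suc; NonZero; _!; _≡ᵇ_; _∸_; _≤_; _<_; s≤s; z≤n)
  import Data.Nat as ℕ
  import Data.Nat.Properties as ℕ
  open import Data.Nat.Solver using (module +-*-Solver)
  open import Data.Rational using (_+_; _*_)
  open import Relation.Binary.PropositionalEquality

  sumN : ℕ → (ℕ → ℕ) → ℕ
  sumN zero h = 0
  sumN (suc m) h = sumN m h ℕ.+ h m

  sumN-suc : ∀ m h → sumN (suc m) h ≡ h 0 ℕ.+ sumN m (λ i → h (suc i))
  sumN-suc zero h = sym (ℕ.+-identityʳ (h 0))
  sumN-suc (suc m) h rewrite sumN-suc m h = ℕ.+-assoc (h 0) _ _

  sumN-cong : ∀ m {g h : ℕ → ℕ} → (∀ i → i < m → g i ≡ h i) → sumN m g ≡ sumN m h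
  sumN-cong zero e = refl
  sumN-cong (suc m) e = cong₂ ℕ._+_ (sumN-cong m (λ i i<m → e i (ℕ.m<n⇒m<1+n i<m))) (e m ℕ.≤-refl)

  antidiagonalSum≡sumN : ∀ n F → antidiagonalSum n F ≡ sumN (suc n) (λ a → F a (n ∸ a))
  antidiagonalSum≡sumN zero F = refl
  antidiagonalSum≡sumN (suc n) F = trans (cong (F 0 (suc n) ℕ.+_) (antidiagonalSum≡sumN n (λ a b → F (suc a) b)))
                                        (sym (sumN-suc (suc n) (λ a → F a (suc n ∸ a))))

  sumBelow-fromℕQ : ∀ m h → sumBelow m (λ i → fromℕQ (h i)) ≡ fromℕQ (sumN m h)
  sumBelow-fromℕQ zero h = refl
  sumBelow-fromℕQ (suc m) h = trans (cong (_+ fromℕQ (h m)) (sumBelow-fromℕQ m h)) (fromℕQ-+ (sumN m h) (h m))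

  sumBelow-Fr : ∀ m h d .{{_ : NonZero d}} → sumBelow m (λ k → Fr (h k) d) ≡ Fr (sumN m h) d
  sumBelow-Fr zero h d = Fr-cong 0 1 0 d refl
  sumBelow-Fr (suc m) h d = trans (cong (_+ Fr (h m) d) (sumBelow-Fr m h d))
    (trans (Fr-+ (sumN m h) d (h m) d)
    (Fr-cong (sumN m h ℕ.* d ℕ.+ h m ℕ.* d) (d ℕ.* d) (sumN m h ℕ.+ h m) d {{ℕ.m*n≢0 d d}}
       (solve 3 (λ x y d → (x :* d :+ y :* d) :* d := (x :+ y) :* (d :* d)) refl (sumN m h) (h m) d)))
    where open +-*-Solver

  xOver1mxℕ : ℕ → ℕ
  xOver1mxℕ i = if i ≡ᵇ 0 then 0 else 1

  -- coefficient of xⁿ in (x/(1 − x))ᵏ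
  powCoeff : ℕ → ℕ → ℕ
  powCoeff zero n = if n ≡ᵇ 0 then 1 else 0
  powCoeff (suc k) n = sumN (suc n) (λ i → xOver1mxℕ i ℕ.* powCoeff k (n ∸ i))

  powS-xOver1mx≡powCoeff : ∀ k n → powS xOver1mx k n ≡ fromℕQ (powCoeff k n)
  powS-xOver1mx≡powCoeff zero zero = refl
  powS-xOver1mx≡powCoeff zero (suc n) = refl
  powS-xOver1mx≡powCoeff (suc k) n =
    trans (sumBelow-cong (suc n) (λ i _ → trans (cong₂ _*_ (xOver1mx≡ i) (powS-xOver1mx≡powCoeff k (n ∸ i)))
                                                (fromℕQ-* (xOver1mxℕ i) (powCoeff k (n ∸ i)))))
          (sumBelow-fromℕQ (suc n) (λ i → xOver1mxℕ i ℕ.* powCoeff k (n ∸ i)))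
    where
    xOver1mx≡ : ∀ i → xOver1mx i ≡ fromℕQ (xOver1mxℕ i)
    xOver1mx≡ zero = refl
    xOver1mx≡ (suc i) = refl

  private
    powCoeff-suc-suc-sum : ∀ k n → powCoeff (suc k) (suc n) ≡ sumN (suc n) (λ i → powCoeff k (n ∸ i))
    powCoeff-suc-suc-sum k n = trans (sumN-suc (suc n) _) (sumN-cong (suc n) (λ i _ → ℕ.+-identityʳ _))

    sum-powCoeff≡choose : ∀ n k → sumN (suc n) (λ i → powCoeff k (n ∸ i)) ≡ choose n k
    sum-powCoeff≡choose zero zero = refl
    sum-powCoeff≡choose zero (suc k) = refl
    sum-powCoeff≡choose (suc n) zero = trans (sumN-suc (suc n) _) (sum-powCoeff≡choose n zero)
    sum-powCoeff≡choose (suc n) (suc k) = trans (sumN-suc (suc n) _)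
      (cong₂ ℕ._+_ (trans (powCoeff-suc-suc-sum k n) (sum-powCoeff≡choose n k)) (sum-powCoeff≡choose n (suc k)))

  powCoeff-suc-suc : ∀ k n → powCoeff (suc k) (suc n) ≡ choose n k
  powCoeff-suc-suc k n = trans (powCoeff-suc-suc-sum k n) (sum-powCoeff≡choose n k)

  powCoeff≤choose : ∀ k n → powCoeff k n ≤ choose n k
  powCoeff≤choose zero zero = ℕ.≤-refl
  powCoeff≤choose zero (suc n) = z≤n
  powCoeff≤choose (suc k) zero = z≤n
  powCoeff≤choose (suc k) (suc n) = ℕ.≤-trans (ℕ.≤-reflexive (powCoeff-suc-suc k n)) (ℕ.m≤m+n (choose n k) (choose n (suc k)))

  private
    choose-*-suc-! : ∀ k j → choose (k ℕ.+ j) k ℕ.* suc (k ℕ.+ j) ! ≡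
                               choose (suc (k ℕ.+ j)) (suc k) ℕ.* rising (suc k) j ℕ.* suc k !
    choose-*-suc-! k j = ℕ.*-cancelʳ-≡ _ _ (k ! ℕ.* j !) {{ℕ._!*_!≢0 k j}} (begin
        choose (k ℕ.+ j) k ℕ.* suc (k ℕ.+ j) ! ℕ.* (k ! ℕ.* j !)
      ≡⟨ solve 4 (λ x f K J → x :* f :* (K :* J) := (x :* (K :* J)) :* f) refl
               (choose (k ℕ.+ j) k) (suc (k ℕ.+ j) !) (k !) (j !) ⟩
        choose (k ℕ.+ j) k ℕ.* (k ! ℕ.* j !) ℕ.* suc (k ℕ.+ j) !
      ≡⟨ cong (ℕ._* suc (k ℕ.+ j) !) (choose-*-!-*-! (k ℕ.+ j) k j refl) ⟩
        (k ℕ.+ j) ! ℕ.* suc (k ℕ.+ j) !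
      ≡⟨ sym (cong₂ ℕ._*_ (rising-*-! k j) (choose-*-!-*-! (suc (k ℕ.+ j)) (suc k) j refl)) ⟩
        rising (suc k) j ℕ.* k ! ℕ.* (choose (suc (k ℕ.+ j)) (suc k) ℕ.* (suc k ! ℕ.* j !))
      ≡⟨ solve 5 (λ y r sk K J → r :* K :* (y :* (sk :* J)) := y :* r :* sk :* (K :* J)) refl
               (choose (suc (k ℕ.+ j)) (suc k)) (rising (suc k) j) (suc k !) (k !) (j !) ⟩
        choose (suc (k ℕ.+ j)) (suc k) ℕ.* rising (suc k) j ℕ.* suc k ! ℕ.* (k ! ℕ.* j !) ∎)
      where
      open ≡-Reasoning
      open +-*-Solver

  powCoeff-*-! : ∀ n k → k ≤ n → powCoeff k n ℕ.* n ! ≡ choose n k ℕ.* rising k (n ∸ k) ℕ.* k !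
  powCoeff-*-! zero zero _ = refl
  powCoeff-*-! (suc n) zero _ = refl
  powCoeff-*-! (suc n) (suc k) (s≤s k≤n) = begin
      powCoeff (suc k) (suc n) ℕ.* suc n !
    ≡⟨ cong (ℕ._* suc n !) (powCoeff-suc-suc k n) ⟩
      choose n k ℕ.* suc n !
    ≡⟨ subst (λ m → choose m k ℕ.* suc m ! ≡ choose (suc m) (suc k) ℕ.* rising (suc k) (m ∸ k) ℕ.* suc k !)
             (ℕ.m+[n∸m]≡n k≤n)
             (subst (λ j → choose (k ℕ.+ (n ∸ k)) k ℕ.* suc (k ℕ.+ (n ∸ k)) ! ≡
                           choose (suc (k ℕ.+ (n ∸ k))) (suc k) ℕ.* rising (suc k) j ℕ.* suc k !)
                    (sym (ℕ.m+n∸m≡n k (n ∸ k))) (choose-*-suc-! k (n ∸ k))) ⟩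
      choose (suc n) (suc k) ℕ.* rising (suc k) (n ∸ k) ℕ.* suc k ! ∎
    where open ≡-Reasoning

  invFact-*-fromℕQ : ∀ k b → invFact k * fromℕQ b ≡ Fr b (k !) {{k ℕ.!≢0}}
  invFact-*-fromℕQ k b = trans (Fr-* 1 (k !) b 1 {{k ℕ.!≢0}})
    (Fr-cong (1 ℕ.* b) (k ! ℕ.* 1) b (k !) {{ℕ.m*n≢0 (k !) 1 {{k ℕ.!≢0}}}} {{k ℕ.!≢0}}
             (cong₂ ℕ._*_ (ℕ.*-identityˡ b) (sym (ℕ.*-identityʳ (k !)))))

  expS-term≡ : ∀ k n → invFact k * powS xOver1mx k n ≡ Fr (powCoeff k n) (k !) {{k ℕ.!≢0}}
  expS-term≡ k n = trans (cong (invFact k *_) (powS-xOver1mx≡powCoeff k n)) (invFact-*-fromℕQ k (powCoeff k n))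

  egf-f-S₀ : ∀ n → egf (f S₀) n ≡ expS xOver1mx n
  egf-f-S₀ n = begin
      Fr (f S₀ n) (n !) {{n ℕ.!≢0}}
    ≡⟨ cong (λ x → Fr x (n !) {{n ℕ.!≢0}})
            (trans (f-S₀≡ n) (antidiagonalSum≡sumN n (λ a b → choose n a ℕ.* rising a b))) ⟩
      Fr (sumN (suc n) summand) (n !) {{n ℕ.!≢0}}
    ≡⟨ sym (sumBelow-Fr (suc n) summand (n !) {{n ℕ.!≢0}}) ⟩
      sumBelow (suc n) (λ k → Fr (summand k) (n !) {{n ℕ.!≢0}})
    ≡⟨ sumBelow-cong (suc n) (λ k k<1+n →
         trans (Fr-cong (summand k) (n !) (powCoeff k n) (k !) {{n ℕ.!≢0}} {{k ℕ.!≢0}} (sym (powCoeff-*-! n k (ℕ.≤-pred k<1+n))))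
               (sym (expS-term≡ k n))) ⟩
      sumBelow (suc n) (λ k → invFact k * powS xOver1mx k n) ∎
    where
    open ≡-Reasoning
    summand : ℕ → ℕ
    summand k = choose n k ℕ.* rising k (n ∸ k)

  egf-t-S₀ : ∀ n → egf (t S₀) n ≡ xOver1mx n
  egf-t-S₀ zero = refl
  egf-t-S₀ (suc m) = trans (cong (λ x → Fr x (suc m !) {{suc m ℕ.!≢0}}) (t-S₀≡! (suc m) (s≤s z≤n)))
    (Fr-cong (suc m !) (suc m !) 1 1 {{suc m ℕ.!≢0}} (trans (ℕ.*-identityʳ _) (sym (ℕ.*-identityˡ _))))

module EulerNumber where

  open import Defs using (sumBelow; powQ; fromℕQ; invFact; eSum)
  open Binomial
  open Fractions
  open RationalFacts
  open import Data.Nat using (ℕ; zero; suc; NonZero; _!; _^_; _∸_)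
  import Data.Nat as ℕ
  import Data.Nat.Properties as ℕ
  open import Data.Nat.Solver using (module +-*-Solver)
  open import Data.Rational using (ℚ; _+_; _*_; -_; 0ℚ; 1ℚ; _≤_; _<_)
  import Data.Rational.Properties as ℚ
  import Data.Rational.Solver as ℚ-Solver
  open import Relation.Binary.PropositionalEquality

  0≤eSum : ∀ m → 0ℚ ≤ eSum m
  0≤eSum m = 0≤sumBelow m (λ k _ → 0≤Fr 1 (k !) {{k ℕ.!≢0}})

  invFact≤1 : ∀ j → invFact j ≤ 1ℚ
  invFact≤1 j = Fr-≤ 1 (j !) 1 1 {{j ℕ.!≢0}} (ℕ.≤-trans (ℕ.1≤n! j) (ℕ.≤-reflexive (sym (ℕ.*-identityˡ (j !)))))

  eSum≤fromℕQ : ∀ n → eSum n ≤ fromℕQ n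
  eSum≤fromℕQ n = ℚ.≤-trans (sumBelow-mono-≤ n (λ j _ → invFact≤1 j)) (ℚ.≤-reflexive (sumBelow-1 n))
    where
    sumBelow-1 : ∀ n → sumBelow n (λ _ → 1ℚ) ≡ fromℕQ n
    sumBelow-1 zero = refl
    sumBelow-1 (suc n) = trans (cong (_+ 1ℚ) (sumBelow-1 n)) (sym (fromℕQ-suc n))

  -- Termwise, choose n k / nᵏ ≤ 1 / k!.
  powQ-1+1/n≤eSum : ∀ m → powQ (1ℚ + Fr 1 (suc m)) (suc m) ≤ eSum (suc (suc m))
  powQ-1+1/n≤eSum m = ℚ.≤-trans (ℚ.≤-reflexive (powQ-1+x≡binomialSum (Fr 1 n) n)) (sumBelow-mono-≤ (suc n) term≤)
    where
    n = suc m
    term≤ : ∀ k → k ℕ.< suc n → fromℕQ (choose n k) * powQ (Fr 1 n) k ≤ invFact k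
    term≤ k _ = ℚ.≤-trans
      (ℚ.≤-reflexive (trans (cong (fromℕQ (choose n k) *_) (powQ-1/d n k)) (Fr-* (choose n k) 1 1 (n ^ k) {{_}} {{ℕ.m^n≢0 n k}})))
      (Fr-≤ (choose n k ℕ.* 1) (1 ℕ.* n ^ k) 1 (k !) {{ℕ.m*n≢0 1 (n ^ k) {{_}} {{ℕ.m^n≢0 n k}}}} {{k ℕ.!≢0}}
        (ℕ.≤-trans (ℕ.≤-reflexive (cong (ℕ._* k !) (ℕ.*-identityʳ (choose n k))))
          (ℕ.≤-trans (choose-*-!≤^ n k) (ℕ.≤-reflexive (sym (trans (ℕ.*-identityˡ _) (ℕ.*-identityˡ _)))))))

  fromℕQ-suc≡*1+1/ : ∀ m → fromℕQ (suc (suc m)) ≡ fromℕQ (suc m) * (1ℚ + Fr 1 (suc m))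
  fromℕQ-suc≡*1+1/ m = sym (begin
      fromℕQ n * (1ℚ + Fr 1 n)
    ≡⟨ ℚ.*-distribˡ-+ (fromℕQ n) 1ℚ (Fr 1 n) ⟩
      fromℕQ n * 1ℚ + fromℕQ n * Fr 1 n
    ≡⟨ cong₂ _+_ (ℚ.*-identityʳ (fromℕQ n))
                 (trans (Fr-* n 1 1 n)
                        (Fr-cong (n ℕ.* 1) (1 ℕ.* n) 1 1 (solve 1 (λ n → n :* con 1 :* con 1 := con 1 :* (con 1 :* n)) refl n))) ⟩
      fromℕQ n + fromℕQ 1
    ≡⟨ sym (fromℕQ-suc n) ⟩
      fromℕQ (suc n) ∎)
    where
    open ≡-Reasoning
    open +-*-Solver
    n = suc m

  [1+n]^n≤n^n*eSum : ∀ m → fromℕQ (suc (suc m) ^ suc m) ≤ fromℕQ (suc m ^ suc m) * eSum (suc (suc m))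
  [1+n]^n≤n^n*eSum m = ℚ.≤-trans (ℚ.≤-reflexive split) (*-monoʳ-≤-0≤ (0≤fromℕQ (n ^ n)) (powQ-1+1/n≤eSum m))
    where
    n = suc m
    split : fromℕQ (suc n ^ n) ≡ fromℕQ (n ^ n) * powQ (1ℚ + Fr 1 n) n
    split = begin
        fromℕQ (suc n ^ n)
      ≡⟨ sym (powQ-fromℕQ (suc n) n) ⟩
        powQ (fromℕQ (suc n)) n
      ≡⟨ cong (λ z → powQ z n) (fromℕQ-suc≡*1+1/ m) ⟩
        powQ (fromℕQ n * (1ℚ + Fr 1 n)) n
      ≡⟨ powQ-*-distrib (fromℕQ n) (1ℚ + Fr 1 n) n ⟩
        powQ (fromℕQ n) n * powQ (1ℚ + Fr 1 n) n
      ≡⟨ cong (_* powQ (1ℚ + Fr 1 n) n) (powQ-fromℕQ n n) ⟩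
        fromℕQ (n ^ n) * powQ (1ℚ + Fr 1 n) n ∎
      where open ≡-Reasoning

  bernoulli : ∀ ε → 0ℚ ≤ ε → ∀ n → 1ℚ + fromℕQ n * ε ≤ powQ (1ℚ + ε) n
  bernoulli ε 0≤ε zero = ℚ.≤-reflexive (trans (cong (1ℚ +_) (ℚ.*-zeroˡ ε)) (ℚ.+-identityʳ 1ℚ))
  bernoulli ε 0≤ε (suc n) = begin
      1ℚ + fromℕQ (suc n) * ε
    ≡⟨ cong (λ z → 1ℚ + z * ε) (fromℕQ-suc n) ⟩
      1ℚ + (fromℕQ n + 1ℚ) * ε
    ≡⟨ expand (fromℕQ n) ε ⟩
      (1ℚ + ε) * (1ℚ + fromℕQ n * ε) + - (fromℕQ n * ε * ε)
    ≤⟨ ℚ.+-monoʳ-≤ ((1ℚ + ε) * (1ℚ + fromℕQ n * ε)) (ℚ.neg-antimono-≤ (0≤* (0≤* (0≤fromℕQ n) 0≤ε) 0≤ε)) ⟩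
      (1ℚ + ε) * (1ℚ + fromℕQ n * ε) + - 0ℚ
    ≡⟨ ℚ.+-identityʳ _ ⟩
      (1ℚ + ε) * (1ℚ + fromℕQ n * ε)
    ≤⟨ *-monoʳ-≤-0≤ (ℚ.≤-trans 0≤1 (x≤x+y 0≤ε)) (bernoulli ε 0≤ε n) ⟩
      (1ℚ + ε) * powQ (1ℚ + ε) n ∎
    where
    open ℚ.≤-Reasoning
    open ℚ-Solver.+-*-Solver
    expand : ∀ x e → 1ℚ + (x + 1ℚ) * e ≡ (1ℚ + e) * (1ℚ + x * e) + - (x * e * e)
    expand = solve 2 (λ x e → con 1ℚ :+ (x :+ con 1ℚ) :* e := (con 1ℚ :+ e) :* (con 1ℚ :+ x :* e) :+ :- (x :* e :* e)) refl

  [a+d]^[1+j]≤ : ∀ a d j → (a ℕ.+ d) ^ suc j ℕ.≤ a ^ suc j ℕ.+ suc j ℕ.* d ℕ.* (a ℕ.+ d) ^ j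
  [a+d]^[1+j]≤ a d zero = ℕ.≤-reflexive (solve 2 (λ a d → (a :+ d) :* con 1 := a :* con 1 :+ con 1 :* d :* con 1) refl a d)
    where open +-*-Solver
  [a+d]^[1+j]≤ a d (suc j) = begin
      (a ℕ.+ d) ℕ.* (a ℕ.+ d) ^ suc j
    ≤⟨ ℕ.*-monoʳ-≤ (a ℕ.+ d) ([a+d]^[1+j]≤ a d j) ⟩
      (a ℕ.+ d) ℕ.* (a ^ suc j ℕ.+ suc j ℕ.* d ℕ.* (a ℕ.+ d) ^ j)
    ≡⟨ solve 4 (λ a d P Q → (a :+ d) :* (P :+ Q) := a :* P :+ d :* P :+ (a :+ d) :* Q) refl
             a d (a ^ suc j) (suc j ℕ.* d ℕ.* (a ℕ.+ d) ^ j) ⟩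
      a ℕ.* a ^ suc j ℕ.+ d ℕ.* a ^ suc j ℕ.+ (a ℕ.+ d) ℕ.* (suc j ℕ.* d ℕ.* (a ℕ.+ d) ^ j)
    ≤⟨ ℕ.+-monoˡ-≤ _ (ℕ.+-monoʳ-≤ (a ℕ.* a ^ suc j) (ℕ.*-monoʳ-≤ d (ℕ.^-monoˡ-≤ (suc j) (ℕ.m≤m+n a d)))) ⟩
      a ℕ.* a ^ suc j ℕ.+ d ℕ.* (a ℕ.+ d) ^ suc j ℕ.+ (a ℕ.+ d) ℕ.* (suc j ℕ.* d ℕ.* (a ℕ.+ d) ^ j)
    ≡⟨ solve 5 (λ A d s Y j → A :+ d :* (s :* Y) :+ s :* ((con 1 :+ j) :* d :* Y)
                           := A :+ (con 1 :+ (con 1 :+ j)) :* d :* (s :* Y)) refl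
             (a ℕ.* a ^ suc j) d (a ℕ.+ d) ((a ℕ.+ d) ^ j) j ⟩
      a ^ suc (suc j) ℕ.+ suc (suc j) ℕ.* d ℕ.* (a ℕ.+ d) ^ suc j ∎
    where
    open ℕ.≤-Reasoning
    open +-*-Solver

  k^M*k≤ : ∀ k M → M ℕ.≤ k → k ^ M ℕ.* k ℕ.≤ (k ∸ M) ^ M ℕ.* k ℕ.+ M ℕ.* M ℕ.* k ^ M
  k^M*k≤ k zero _ = ℕ.m≤m+n (1 ℕ.* k) 0
  k^M*k≤ k (suc m) M≤k = begin
      k ^ M ℕ.* k
    ≡⟨ cong (λ z → z ^ M ℕ.* k) (sym c+M≡k) ⟩
      (c ℕ.+ M) ^ M ℕ.* k
    ≤⟨ ℕ.*-monoˡ-≤ k ([a+d]^[1+j]≤ c M m) ⟩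
      (c ^ M ℕ.+ M ℕ.* M ℕ.* (c ℕ.+ M) ^ m) ℕ.* k
    ≡⟨ cong (λ z → (c ^ M ℕ.+ M ℕ.* M ℕ.* z ^ m) ℕ.* k) c+M≡k ⟩
      (c ^ M ℕ.+ M ℕ.* M ℕ.* k ^ m) ℕ.* k
    ≡⟨ solve 4 (λ A B K k → (A :+ B :* K) :* k := A :* k :+ B :* (k :* K)) refl (c ^ M) (M ℕ.* M) (k ^ m) k ⟩
      c ^ M ℕ.* k ℕ.+ M ℕ.* M ℕ.* k ^ M ∎
    where
    open ℕ.≤-Reasoning
    open +-*-Solver
    M = suc m
    c = k ∸ M
    c+M≡k : c ℕ.+ M ≡ k
    c+M≡k = ℕ.m∸n+n≡m M≤k

  [k∸M]^M*k^j≤ : ∀ k M j → M ℕ.≤ k → j ℕ.≤ M → (k ∸ M) ^ M ℕ.* k ^ j ℕ.≤ choose k j ℕ.* (k ^ M ℕ.* j !)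
  [k∸M]^M*k^j≤ k M j M≤k j≤M = begin
      c ^ M ℕ.* k ^ j
    ≡⟨ cong (λ z → c ^ z ℕ.* k ^ j) (sym (ℕ.m+[n∸m]≡n j≤M)) ⟩
      c ^ (j ℕ.+ (M ∸ j)) ℕ.* k ^ j
    ≡⟨ cong (ℕ._* k ^ j) (ℕ.^-distribˡ-+-* c j (M ∸ j)) ⟩
      c ^ j ℕ.* c ^ (M ∸ j) ℕ.* k ^ j
    ≤⟨ ℕ.*-monoˡ-≤ (k ^ j) (ℕ.*-monoʳ-≤ (c ^ j) (ℕ.^-monoˡ-≤ (M ∸ j) (ℕ.m∸n≤m k M))) ⟩
      c ^ j ℕ.* k ^ (M ∸ j) ℕ.* k ^ j
    ≡⟨ ℕ.*-assoc (c ^ j) (k ^ (M ∸ j)) (k ^ j) ⟩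
      c ^ j ℕ.* (k ^ (M ∸ j) ℕ.* k ^ j)
    ≡⟨ cong (c ^ j ℕ.*_) (trans (sym (ℕ.^-distribˡ-+-* k (M ∸ j) j)) (cong (k ^_) (ℕ.m∸n+n≡m j≤M))) ⟩
      c ^ j ℕ.* k ^ M
    ≤⟨ ℕ.*-monoˡ-≤ (k ^ M) (^≤choose-*-! k j c (ℕ.≤-trans (ℕ.+-monoʳ-≤ c j≤M) (ℕ.≤-reflexive (ℕ.m∸n+n≡m M≤k)))) ⟩
      choose k j ℕ.* j ! ℕ.* k ^ M
    ≡⟨ trans (ℕ.*-assoc (choose k j) (j !) (k ^ M)) (cong (choose k j ℕ.*_) (ℕ.*-comm (j !) (k ^ M))) ⟩
      choose k j ℕ.* (k ^ M ℕ.* j !) ∎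
    where
    open ℕ.≤-Reasoning
    c = k ∸ M

  private
    +-cancelʳ-≤ : ∀ {a b} c → a + c ≤ b + c → a ≤ b
    +-cancelʳ-≤ {a} {b} c a+c≤b+c =
      ℚ.≤-trans (ℚ.≤-reflexive (sym (cancel a))) (ℚ.≤-trans (ℚ.+-monoˡ-≤ (- c) a+c≤b+c) (ℚ.≤-reflexive (cancel b)))
      where
      cancel : ∀ x → (x + c) + (- c) ≡ x
      cancel x = trans (ℚ.+-assoc x c (- c)) (trans (cong (x +_) (ℚ.+-inverseʳ c)) (ℚ.+-identityʳ x))

  -- With S = eSum (M + 1), X = ((k ∸ M)/k)^M and Y = M²/k we have 1 ≤ X + Y, S X ≤ (1 + 1/k)^k
  -- (termwise against the binomial expansion) and S Y ≤ 1/M! (since S ≤ M + 1); subtract 1/M!.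
  eSum≤powQ-1+1/k : ∀ m k → m ℕ.≤ suc k → suc m ℕ.* (m ℕ.* m) ℕ.* m ! ℕ.≤ suc k →
    eSum m ≤ powQ (1ℚ + Fr 1 (suc k)) (suc k)
  eSum≤powQ-1+1/k zero k _ _ = 0≤powQ (suc k) (ℚ.≤-trans 0≤1 (x≤x+y (0≤Fr 1 (suc k))))
  eSum≤powQ-1+1/k (suc m) k′ M≤k large = +-cancelʳ-≤ (invFact M) (begin
      S
    ≡⟨ sym (ℚ.*-identityʳ S) ⟩
      S * 1ℚ
    ≤⟨ *-monoʳ-≤-0≤ (0≤eSum (suc M)) 1≤X+Y ⟩
      S * (X + Y)
    ≡⟨ ℚ.*-distribˡ-+ S X Y ⟩
      S * X + S * Y
    ≤⟨ ℚ.+-mono-≤ SX≤ SY≤ ⟩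
      powQ (1ℚ + Fr 1 k) k + invFact M ∎)
    where
    open ℚ.≤-Reasoning
    k = suc k′
    M = suc m
    c = k ∸ M
    instance
      k^M≢0 : NonZero (k ^ M)
      k^M≢0 = ℕ.m^n≢0 k M
    X = Fr (c ^ M) (k ^ M)
    Y = Fr (M ℕ.* M) k
    S = eSum (suc M)
    term≤ : ∀ j → j ℕ.< suc M → X * invFact j ≤ fromℕQ (choose k j) * powQ (Fr 1 k) j
    term≤ j j<1+M = ℚ.≤-trans (ℚ.≤-reflexive (Fr-* (c ^ M) (k ^ M) 1 (j !) {{k^M≢0}} {{j ℕ.!≢0}}))
      (ℚ.≤-trans (Fr-≤ (c ^ M ℕ.* 1) (k ^ M ℕ.* j !) (choose k j ℕ.* 1) (1 ℕ.* k ^ j)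
                       {{ℕ.m*n≢0 (k ^ M) (j !) {{k^M≢0}} {{j ℕ.!≢0}}}} {{ℕ.m*n≢0 1 (k ^ j) {{_}} {{ℕ.m^n≢0 k j}}}}
         (ℕ.≤-trans (ℕ.≤-reflexive (cong₂ ℕ._*_ (ℕ.*-identityʳ (c ^ M)) (ℕ.*-identityˡ (k ^ j))))
           (ℕ.≤-trans ([k∸M]^M*k^j≤ k M j M≤k (ℕ.≤-pred j<1+M))
                      (ℕ.≤-reflexive (cong (ℕ._* (k ^ M ℕ.* j !)) (sym (ℕ.*-identityʳ (choose k j))))))))
       (ℚ.≤-reflexive (sym (trans (cong (fromℕQ (choose k j) *_) (powQ-1/d k j))
                                  (Fr-* (choose k j) 1 1 (k ^ j) {{_}} {{ℕ.m^n≢0 k j}})))))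
    SX≤ : S * X ≤ powQ (1ℚ + Fr 1 k) k
    SX≤ = begin
        S * X
      ≡⟨ trans (ℚ.*-comm S X) (*-sumBelow (suc M) X invFact) ⟩
        sumBelow (suc M) (λ j → X * invFact j)
      ≤⟨ sumBelow-mono-≤ (suc M) term≤ ⟩
        sumBelow (suc M) (λ j → fromℕQ (choose k j) * powQ (Fr 1 k) j)
      ≤⟨ sumBelow-≤-+ (suc M) (k ∸ M) (λ j → 0≤* (0≤fromℕQ (choose k j)) (0≤powQ j (0≤Fr 1 k))) ⟩
        sumBelow (suc M ℕ.+ (k ∸ M)) (λ j → fromℕQ (choose k j) * powQ (Fr 1 k) j)
      ≡⟨ cong (λ z → sumBelow (suc z) (λ j → fromℕQ (choose k j) * powQ (Fr 1 k) j)) (ℕ.m+[n∸m]≡n M≤k) ⟩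
        binomialSum (Fr 1 k) k
      ≡⟨ sym (powQ-1+x≡binomialSum (Fr 1 k) k) ⟩
        powQ (1ℚ + Fr 1 k) k ∎
    1≤X+Y : 1ℚ ≤ X + Y
    1≤X+Y = ℚ.≤-trans (Fr-≤ 1 1 (c ^ M ℕ.* k ℕ.+ M ℕ.* M ℕ.* k ^ M) (k ^ M ℕ.* k) {{_}} {{ℕ.m*n≢0 (k ^ M) k}}
        (ℕ.≤-trans (ℕ.≤-reflexive (ℕ.*-identityˡ (k ^ M ℕ.* k))) (ℕ.≤-trans (k^M*k≤ k M M≤k) (ℕ.≤-reflexive (sym (ℕ.*-identityʳ _))))))
      (ℚ.≤-reflexive (sym (Fr-+ (c ^ M) (k ^ M) (M ℕ.* M) k)))
    SY≤ : S * Y ≤ invFact M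
    SY≤ = ℚ.≤-trans (*-monoˡ-≤-0≤ (0≤Fr (M ℕ.* M) k) (eSum≤fromℕQ (suc M)))
      (ℚ.≤-trans (ℚ.≤-reflexive (Fr-* (suc M) 1 (M ℕ.* M) k))
        (Fr-≤ (suc M ℕ.* (M ℕ.* M)) (1 ℕ.* k) 1 (M !) {{_}} {{M ℕ.!≢0}}
          (ℕ.≤-trans large (ℕ.≤-reflexive (sym (trans (ℕ.*-identityˡ _) (ℕ.*-identityˡ _)))))))

module LowerBound where

  open import Defs
  open ClosedForm using (t-S₀≡!; t-S₀≤f-S₀)
  open Fractions
  open RationalFacts
  open EulerNumber
  open import Data.Nat using (ℕ; zero; suc; _!; _^_; z≤n; s≤s)
  import Data.Nat as ℕ
  import Data.Nat.Properties as ℕ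
  open import Data.Rational using (ℚ; _+_; _*_; 0ℚ; 1ℚ; _≤_; _<_)
  import Data.Rational.Properties as ℚ
  import Data.Rational.Solver as ℚ-Solver
  open import Data.Sum using (inj₁; inj₂)
  open import Data.Product using (_,_)
  open import Relation.Binary using (Tri; tri<; tri≈; tri>)
  open import Relation.Binary.PropositionalEquality

  module _ (p r : ℚ) (0≤p : 0ℚ ≤ p) (p*e≤r : (m : ℕ) → p * eSum m ≤ r) where

    private
      0≤r : 0ℚ ≤ r
      0≤r = ℚ.≤-trans (ℚ.≤-reflexive (sym (ℚ.*-zeroʳ p))) (p*e≤r 0)

      p≤r : p ≤ r
      p≤r = ℚ.≤-trans (ℚ.≤-reflexive (sym (ℚ.*-identityʳ p))) (p*e≤r 1)

    -- Induction on n, using (n + 1)ⁿ ≤ nⁿ e at each step.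
    p^n*n^n≤r^n*n! : ∀ m → powQ p (suc m) * fromℕQ (suc m ^ suc m) ≤ powQ r (suc m) * fromℕQ (suc m !)
    p^n*n^n≤r^n*n! zero = ℚ.≤-trans (ℚ.≤-reflexive (cong (_* 1ℚ) (ℚ.*-identityʳ p)))
      (ℚ.≤-trans (*-monoˡ-≤-0≤ 0≤1 p≤r) (ℚ.≤-reflexive (cong (_* 1ℚ) (sym (ℚ.*-identityʳ r)))))
    p^n*n^n≤r^n*n! (suc m) = begin
        (p * A) * fromℕQ (suc n ℕ.* suc n ^ n)
      ≡⟨ cong ((p * A) *_) (sym (fromℕQ-* (suc n) (suc n ^ n))) ⟩
        (p * A) * (c * fromℕQ (suc n ^ n))
      ≤⟨ *-monoʳ-≤-0≤ (0≤* 0≤p (0≤powQ n 0≤p)) (*-monoʳ-≤-0≤ (0≤fromℕQ (suc n)) ([1+n]^n≤n^n*eSum m)) ⟩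
        (p * A) * (c * (fromℕQ (n ^ n) * e))
      ≡⟨ regroup p A c (fromℕQ (n ^ n)) e ⟩
        (p * e) * (c * (A * fromℕQ (n ^ n)))
      ≤⟨ *-mono-≤-0≤ (0≤* 0≤p (0≤eSum (suc n)))
           (0≤* (0≤fromℕQ (suc n)) (0≤* (0≤powQ n 0≤p) (0≤fromℕQ (n ^ n))))
           (p*e≤r (suc n)) (*-monoʳ-≤-0≤ (0≤fromℕQ (suc n)) (p^n*n^n≤r^n*n! m)) ⟩
        r * (c * (powQ r n * fromℕQ (n !)))
      ≡⟨ regroup′ r c (powQ r n) (fromℕQ (n !)) ⟩
        (r * powQ r n) * (c * fromℕQ (n !))
      ≡⟨ cong ((r * powQ r n) *_) (fromℕQ-* (suc n) (n !)) ⟩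
        powQ r (suc n) * fromℕQ (suc n !) ∎
      where
      open ℚ.≤-Reasoning
      open ℚ-Solver.+-*-Solver
      n = suc m
      A = powQ p n
      c = fromℕQ (suc n)
      e = eSum (suc n)
      regroup : ∀ p A c B e → (p * A) * (c * (B * e)) ≡ (p * e) * (c * (A * B))
      regroup = solve 5 (λ p A c B e → (p :* A) :* (c :* (B :* e)) := (p :* e) :* (c :* (A :* B))) refl
      regroup′ : ∀ r c R F → r * (c * (R * F)) ≡ (r * R) * (c * F)
      regroup′ = solve 4 (λ r c R F → r :* (c :* (R :* F)) := (r :* R) :* (c :* F)) refl

    [p*n]^n<f-S₀ : r < 1ℚ → ∀ m → powQ (p * fromℕQ (suc m)) (suc m) < fromℕQ (f S₀ (suc m))
    [p*n]^n<f-S₀ r<1 m = begin-strict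
        powQ (p * fromℕQ n) n
      ≡⟨ trans (powQ-*-distrib p (fromℕQ n) n) (cong (powQ p n *_) (powQ-fromℕQ n n)) ⟩
        powQ p n * fromℕQ (n ^ n)
      ≤⟨ p^n*n^n≤r^n*n! m ⟩
        powQ r n * fromℕQ (n !)
      <⟨ *-monoˡ-<-0< (fromℕQ-mono-< {0} {n !} (ℕ.1≤n! n)) r^n<1 ⟩
        1ℚ * fromℕQ (n !)
      ≡⟨ ℚ.*-identityˡ (fromℕQ (n !)) ⟩
        fromℕQ (n !)
      ≤⟨ fromℕQ-mono-≤ (ℕ.≤-trans (ℕ.≤-reflexive (sym (t-S₀≡! n (s≤s z≤n)))) (t-S₀≤f-S₀ n)) ⟩
        fromℕQ (f S₀ n) ∎
      where
      open ℚ.≤-Reasoning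
      n = suc m
      r^n<1 : powQ r n < 1ℚ
      r^n<1 = ℚ.≤-<-trans (ℚ.≤-trans (*-monoʳ-≤-0≤ 0≤r (powQ-≤1 m 0≤r (ℚ.<⇒≤ r<1))) (ℚ.≤-reflexive (ℚ.*-identityʳ r)))
                          r<1

  LtRootOver-f-S₀ : ∀ p → BelowInvE p → ∀ n → n ℕ.≥ 1 → LtRootOver p (f S₀ n) n
  LtRootOver-f-S₀ p (r , r<1 , p*e≤r) (suc m) _ = by-sign (ℚ.<-cmp p 0ℚ)
    where
    by-sign : Tri (p < 0ℚ) (p ≡ 0ℚ) (0ℚ < p) → LtRootOver p (f S₀ (suc m)) (suc m)
    by-sign (tri< p<0 _ _) = inj₁ p<0
    by-sign (tri≈ _ p≡0 _) = inj₂ ([p*n]^n<f-S₀ p r (ℚ.≤-reflexive (sym p≡0)) p*e≤r r<1 m)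
    by-sign (tri> _ _ 0<p) = inj₂ ([p*n]^n<f-S₀ p r (ℚ.<⇒≤ 0<p) p*e≤r r<1 m)

module UpperBound where

  open import Defs
  open Binomial
  open Series using (egf-f-S₀; expS-term≡; powCoeff; powCoeff≤choose)
  open Fractions
  open RationalFacts
  open EulerNumber
  open import Data.Nat using (ℕ; zero; suc; _!; _^_; _∸_; z≤n; s≤s; >-nonZero)
  import Data.Nat as ℕ
  import Data.Nat.Properties as ℕ
  open import Data.Nat.Solver using (module +-*-Solver)
  open import Data.Rational using (ℚ; _+_; _*_; 0ℚ; 1ℚ; _≤_; _<_)
  import Data.Rational.Properties as ℚ
  import Data.Rational.Solver as ℚ-Solver
  open import Algebra.Bundles using (CommutativeMonoid)
  open import Algebra.Properties.CommutativeSemigroup (CommutativeMonoid.commutativeSemigroup ℚ.*-1-commutativeMonoid)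
    using () renaming (interchange to *-interchange)
  open import Data.Product using (Σ; _×_; _,_; proj₁; proj₂)
  open import Relation.Binary.PropositionalEquality

  module _ (s : ℚ) (0≤s : 0ℚ ≤ s) (K′ : ℕ)
           (s≤e : ∀ k → K′ ℕ.≤ k → s ≤ powQ (1ℚ + Fr 1 (suc k)) (suc k)) where

    -- Each factor n + 1 of the factorial is paid for by s ≤ (1 + 1/n)ⁿ = (n + 1)ⁿ / nⁿ.
    !*powQ≤^ : ∀ j → fromℕQ ((suc K′ ℕ.+ j) !) * powQ s j ≤ fromℕQ ((suc K′ ℕ.+ j) ^ (suc K′ ℕ.+ j))
    !*powQ≤^ zero = ℚ.≤-trans (ℚ.≤-reflexive (ℚ.*-identityʳ _)) (fromℕQ-mono-≤ (!≤^ (suc K′ ℕ.+ 0)))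
    !*powQ≤^ (suc j) rewrite ℕ.+-suc K′ j = begin
        fromℕQ (suc n !) * (s * powQ s j)
      ≡⟨ cong (_* (s * powQ s j)) (sym (fromℕQ-* (suc n) (n !))) ⟩
        (fromℕQ (suc n) * fromℕQ (n !)) * (s * powQ s j)
      ≡⟨ *-interchange (fromℕQ (suc n)) (fromℕQ (n !)) s (powQ s j) ⟩
        (fromℕQ (suc n) * s) * (fromℕQ (n !) * powQ s j)
      ≤⟨ *-monoʳ-≤-0≤ (0≤* (0≤fromℕQ (suc n)) 0≤s) (!*powQ≤^ j) ⟩
        (fromℕQ (suc n) * s) * fromℕQ (n ^ n)
      ≤⟨ *-monoˡ-≤-0≤ (0≤fromℕQ (n ^ n)) (*-monoʳ-≤-0≤ (0≤fromℕQ (suc n)) (s≤e (K′ ℕ.+ j) (ℕ.m≤m+n K′ j))) ⟩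
        (fromℕQ (suc n) * powQ (1ℚ + Fr 1 n) n) * fromℕQ (n ^ n)
      ≡⟨ trans (ℚ.*-assoc (fromℕQ (suc n)) _ _) (cong (fromℕQ (suc n) *_) (ℚ.*-comm (powQ (1ℚ + Fr 1 n) n) (fromℕQ (n ^ n)))) ⟩
        fromℕQ (suc n) * (fromℕQ (n ^ n) * powQ (1ℚ + Fr 1 n) n)
      ≡⟨ cong (fromℕQ (suc n) *_) n^n*[1+1/n]^n≡ ⟩
        fromℕQ (suc n) * fromℕQ (suc n ^ n)
      ≡⟨ fromℕQ-* (suc n) (suc n ^ n) ⟩
        fromℕQ (suc n ^ suc n) ∎
      where
      open ℚ.≤-Reasoning
      n = suc (K′ ℕ.+ j)
      n^n*[1+1/n]^n≡ : fromℕQ (n ^ n) * powQ (1ℚ + Fr 1 n) n ≡ fromℕQ (suc n ^ n)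
      n^n*[1+1/n]^n≡ = begin-equality
          fromℕQ (n ^ n) * powQ (1ℚ + Fr 1 n) n
        ≡⟨ cong (_* powQ (1ℚ + Fr 1 n) n) (sym (powQ-fromℕQ n n)) ⟩
          powQ (fromℕQ n) n * powQ (1ℚ + Fr 1 n) n
        ≡⟨ sym (powQ-*-distrib (fromℕQ n) (1ℚ + Fr 1 n) n) ⟩
          powQ (fromℕQ n * (1ℚ + Fr 1 n)) n
        ≡⟨ cong (λ z → powQ z n) (sym (fromℕQ-suc≡*1+1/ (K′ ℕ.+ j))) ⟩
          powQ (fromℕQ (suc n)) n
        ≡⟨ powQ-fromℕQ (suc n) n ⟩
          fromℕQ (suc n ^ n) ∎

  binomialOverFactorial : ℕ → ℚ
  binomialOverFactorial n = sumBelow (suc n) (λ k → Fr (choose n k) (k !) {{k ℕ.!≢0}})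

  f-S₀≤!*binomialOverFactorial : ∀ n → fromℕQ (f S₀ n) ≤ fromℕQ (n !) * binomialOverFactorial n
  f-S₀≤!*binomialOverFactorial n = ℚ.≤-trans (ℚ.≤-reflexive f≡) (*-monoʳ-≤-0≤ (0≤fromℕQ (n !)) egf≤)
    where
    f≡ : fromℕQ (f S₀ n) ≡ fromℕQ (n !) * Fr (f S₀ n) (n !) {{n ℕ.!≢0}}
    f≡ = sym (trans (Fr-* (n !) 1 (f S₀ n) (n !) {{_}} {{n ℕ.!≢0}})
                    (Fr-cong (n ! ℕ.* f S₀ n) (1 ℕ.* n !) (f S₀ n) 1 {{ℕ.m*n≢0 1 (n !) {{_}} {{n ℕ.!≢0}}}}
                      (trans (ℕ.*-identityʳ _) (trans (ℕ.*-comm (n !) (f S₀ n)) (cong (f S₀ n ℕ.*_) (sym (ℕ.*-identityˡ (n !))))))))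
    egf≤ : Fr (f S₀ n) (n !) {{n ℕ.!≢0}} ≤ binomialOverFactorial n
    egf≤ = ℚ.≤-trans (ℚ.≤-reflexive (egf-f-S₀ n))
      (sumBelow-mono-≤ (suc n) (λ k _ → ℚ.≤-trans (ℚ.≤-reflexive (expS-term≡ k n))
        (Fr-≤ (powCoeff k n) (k !) (choose n k) (k !) {{k ℕ.!≢0}} {{k ℕ.!≢0}} (ℕ.*-monoˡ-≤ (k !) (powCoeff≤choose k n)))))

  -- Termwise 1/k! ≤ Dᴰ/Dᵏ.
  binomialOverFactorial≤ : ∀ D′ n → binomialOverFactorial n ≤ fromℕQ (suc D′ ^ suc D′) * powQ (1ℚ + Fr 1 (suc D′)) n
  binomialOverFactorial≤ D′ n = ℚ.≤-trans (sumBelow-mono-≤ (suc n) term≤)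
    (ℚ.≤-reflexive (trans (sym (*-sumBelow (suc n) (fromℕQ (D ^ D)) (λ k → fromℕQ (choose n k) * powQ (Fr 1 D) k)))
                          (cong (fromℕQ (D ^ D) *_) (sym (powQ-1+x≡binomialSum (Fr 1 D) n)))))
    where
    D = suc D′
    term≤ : ∀ k → k ℕ.< suc n → Fr (choose n k) (k !) {{k ℕ.!≢0}} ≤ fromℕQ (D ^ D) * (fromℕQ (choose n k) * powQ (Fr 1 D) k)
    term≤ k _ = ℚ.≤-trans
      (Fr-≤ (choose n k) (k !) (D ^ D ℕ.* (choose n k ℕ.* 1)) (1 ℕ.* (1 ℕ.* D ^ k))
            {{k ℕ.!≢0}} {{ℕ.m*n≢0 1 (1 ℕ.* D ^ k) {{_}} {{ℕ.m*n≢0 1 (D ^ k) {{_}} {{ℕ.m^n≢0 D k}}}}}}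
        (begin
          choose n k ℕ.* (1 ℕ.* (1 ℕ.* D ^ k))
        ≡⟨ cong (choose n k ℕ.*_) (trans (ℕ.*-identityˡ _) (ℕ.*-identityˡ _)) ⟩
          choose n k ℕ.* D ^ k
        ≤⟨ ℕ.*-monoʳ-≤ (choose n k) (^≤^-self-*-! D k (s≤s z≤n)) ⟩
          choose n k ℕ.* (D ^ D ℕ.* k !)
        ≡⟨ solve 3 (λ b A F → b :* (A :* F) := A :* (b :* con 1) :* F) refl (choose n k) (D ^ D) (k !) ⟩
          D ^ D ℕ.* (choose n k ℕ.* 1) ℕ.* k ! ∎))
      (ℚ.≤-reflexive (sym (trans (cong (λ z → fromℕQ (D ^ D) * (fromℕQ (choose n k) * z)) (powQ-1/d D k))
         (trans (cong (fromℕQ (D ^ D) *_) (Fr-* (choose n k) 1 1 (D ^ k) {{_}} {{ℕ.m^n≢0 D k}}))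
                (Fr-* (D ^ D) 1 (choose n k ℕ.* 1) (1 ℕ.* D ^ k) {{_}} {{ℕ.m*n≢0 1 (D ^ k) {{_}} {{ℕ.m^n≢0 D k}}}})))))
      where
      open ℕ.≤-Reasoning
      open +-*-Solver

  -- Writing c = a/d with d < a and D = d + 1, the factor 1 + 1/D leaves 1 + g/h with h = d (D + 1)
  -- and g = a D ∸ h ≥ 1.
  1<⇒[1+g/h]*[1+1/D]≡ : ∀ c → 1ℚ < c → Σ ℕ λ D′ → Σ ℕ λ g → Σ ℕ λ h′ →
    (1 ℕ.≤ g) × ((1ℚ + Fr g (suc h′)) * (1ℚ + Fr 1 (suc D′)) ≡ c)
  1<⇒[1+g/h]*[1+1/D]≡ c 1<c with nonNegative⇒Fr c (ℚ.<⇒≤ (ℚ.<-trans 0<1 1<c))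
  ... | a , d₀ , c≡a/d = d , g , h′ , 1≤g , factorised
    where
    d = suc d₀
    D = suc d
    h′ = D ℕ.+ d₀ ℕ.* suc D
    h = d ℕ.* suc D
    g = a ℕ.* D ∸ h
    d<a : d ℕ.< a
    d<a = ℕ.≤-trans (ℕ.≤-reflexive (cong suc (sym (ℕ.*-identityˡ d))))
            (ℕ.≤-trans (Fr-<⁻¹ 1 1 a d (ℚ.<-≤-trans 1<c (ℚ.≤-reflexive c≡a/d))) (ℕ.≤-reflexive (ℕ.*-identityʳ a)))
    h<aD : h ℕ.< a ℕ.* D
    h<aD = ℕ.≤-trans (ℕ.≤-reflexive (solve 1 (λ x → con 1 :+ (con 1 :+ x) :* (con 3 :+ x) := (con 2 :+ x) :* (con 2 :+ x))
                                           refl d₀))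
                     (ℕ.*-monoˡ-≤ D d<a)
      where open +-*-Solver
    1≤g : 1 ℕ.≤ g
    1≤g = ℕ.≤-trans (ℕ.≤-reflexive (sym (ℕ.m+n∸m≡n h 1)))
                    (ℕ.∸-monoˡ-≤ h (ℕ.≤-trans (ℕ.≤-reflexive (ℕ.+-comm h 1)) h<aD))
    factorised : (1ℚ + Fr g h) * (1ℚ + Fr 1 D) ≡ c
    factorised = begin
        (Fr 1 1 + Fr g h) * (Fr 1 1 + Fr 1 D)
      ≡⟨ cong₂ _*_ (Fr-+ 1 1 g h) (Fr-+ 1 1 1 D) ⟩
        Fr (1 ℕ.* h ℕ.+ g ℕ.* 1) (1 ℕ.* h) * Fr (1 ℕ.* D ℕ.+ 1 ℕ.* 1) (1 ℕ.* D)
      ≡⟨ Fr-* (1 ℕ.* h ℕ.+ g ℕ.* 1) (1 ℕ.* h) (1 ℕ.* D ℕ.+ 1 ℕ.* 1) (1 ℕ.* D) ⟩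
        Fr ((1 ℕ.* h ℕ.+ g ℕ.* 1) ℕ.* (1 ℕ.* D ℕ.+ 1 ℕ.* 1)) (1 ℕ.* h ℕ.* (1 ℕ.* D))
      ≡⟨ Fr-cong ((1 ℕ.* h ℕ.+ g ℕ.* 1) ℕ.* (1 ℕ.* D ℕ.+ 1 ℕ.* 1)) (1 ℕ.* h ℕ.* (1 ℕ.* D)) a d cross ⟩
        Fr a d
      ≡⟨ sym c≡a/d ⟩
        c ∎
      where
      open ≡-Reasoning
      open +-*-Solver
      cross : (1 ℕ.* h ℕ.+ g ℕ.* 1) ℕ.* (1 ℕ.* D ℕ.+ 1 ℕ.* 1) ℕ.* d ≡ a ℕ.* (1 ℕ.* h ℕ.* (1 ℕ.* D))
      cross = begin
          (1 ℕ.* h ℕ.+ g ℕ.* 1) ℕ.* (1 ℕ.* D ℕ.+ 1 ℕ.* 1) ℕ.* d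
        ≡⟨ solve 4 (λ h g D d → (con 1 :* h :+ g :* con 1) :* (con 1 :* D :+ con 1 :* con 1) :* d
                              := (h :+ g) :* ((con 1 :+ D) :* d)) refl h g D d ⟩
          (h ℕ.+ g) ℕ.* (suc D ℕ.* d)
        ≡⟨ cong (ℕ._* (suc D ℕ.* d)) (ℕ.m+[n∸m]≡n (ℕ.<⇒≤ h<aD)) ⟩
          a ℕ.* D ℕ.* (suc D ℕ.* d)
        ≡⟨ solve 4 (λ a D sD d → a :* D :* (sD :* d) := a :* (con 1 :* (d :* sD) :* (con 1 :* D))) refl a D (suc D) d ⟩
          a ℕ.* (1 ℕ.* h ℕ.* (1 ℕ.* D)) ∎

  -- Bernoulli: (1 + g/h)ⁿ ≥ 1 + n g/h ≥ n/h.
  powQ-1+g/h-unbounded : ∀ A → 0ℚ ≤ A → ∀ g h′ → 1 ℕ.≤ g →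
    Σ ℕ λ N → ∀ n → N ℕ.≤ n → A < powQ (1ℚ + Fr g (suc h′)) n
  powQ-1+g/h-unbounded A 0≤A g h′ 1≤g with nonNegative⇒Fr A 0≤A
  ... | α , β₀ , A≡α/β = suc (α ℕ.* h) , λ n N≤n → begin-strict
      A
    ≡⟨ A≡α/β ⟩
      Fr α β
    <⟨ Fr-< α β n h (ℕ.≤-trans N≤n (ℕ.m≤m*n n β)) ⟩
      Fr n h
    ≤⟨ Fr-≤ n h (n ℕ.* g) (1 ℕ.* h)
            (ℕ.≤-trans (ℕ.≤-reflexive (cong (n ℕ.*_) (ℕ.*-identityˡ h)))
                       (ℕ.*-monoˡ-≤ h (ℕ.≤-trans (ℕ.≤-reflexive (sym (ℕ.*-identityʳ n))) (ℕ.*-monoʳ-≤ n 1≤g)))) ⟩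
      Fr (n ℕ.* g) (1 ℕ.* h)
    ≡⟨ sym (Fr-* n 1 g h) ⟩
      fromℕQ n * Fr g h
    ≤⟨ ℚ.≤-trans (x≤x+y 0≤1) (ℚ.≤-reflexive (ℚ.+-comm (fromℕQ n * Fr g h) 1ℚ)) ⟩
      1ℚ + fromℕQ n * Fr g h
    ≤⟨ bernoulli (Fr g h) (0≤Fr g h) n ⟩
      powQ (1ℚ + Fr g h) n ∎
    where
    open ℚ.≤-Reasoning
    h = suc h′
    β = suc β₀

  module _ (q s : ℚ) (0≤s : 0ℚ ≤ s) (K′ : ℕ)
           (s≤e : ∀ k → K′ ℕ.≤ k → s ≤ powQ (1ℚ + Fr 1 (suc k)) (suc k))
           (ρ : ℚ) (D′ : ℕ) (ρb≡qs : ρ * (1ℚ + Fr 1 (suc D′)) ≡ q * s) where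

    private
      D = suc D′
      b = 1ℚ + Fr 1 D
      K = suc K′
      A = fromℕQ (D ^ D) * powQ s K

    f-S₀<[q*n]^n : ∀ n → K ℕ.≤ n → A < powQ ρ n → fromℕQ (f S₀ n) < powQ (q * fromℕQ n) n
    f-S₀<[q*n]^n n K≤n A<ρⁿ = *-cancelʳ-<-0≤ (0≤powQ n 0≤s) (begin-strict
        fromℕQ (f S₀ n) * powQ s n
      ≤⟨ *-monoˡ-≤-0≤ (0≤powQ n 0≤s) (ℚ.≤-trans (f-S₀≤!*binomialOverFactorial n)
                                                (*-monoʳ-≤-0≤ (0≤fromℕQ (n !)) (binomialOverFactorial≤ D′ n))) ⟩
        (fromℕQ (n !) * (fromℕQ (D ^ D) * powQ b n)) * powQ s n
      ≡⟨ cong (λ z → (fromℕQ (n !) * (fromℕQ (D ^ D) * powQ b n)) * powQ s z) (sym K+j≡n) ⟩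
        (fromℕQ (n !) * (fromℕQ (D ^ D) * powQ b n)) * powQ s (K ℕ.+ j)
      ≡⟨ cong ((fromℕQ (n !) * (fromℕQ (D ^ D) * powQ b n)) *_) (powQ-+ s K j) ⟩
        (fromℕQ (n !) * (fromℕQ (D ^ D) * powQ b n)) * (powQ s K * powQ s j)
      ≡⟨ regroup (fromℕQ (n !)) (fromℕQ (D ^ D)) (powQ b n) (powQ s K) (powQ s j) ⟩
        (A * powQ b n) * (fromℕQ (n !) * powQ s j)
      ≤⟨ *-monoʳ-≤-0≤ (0≤* 0≤A (0≤powQ n 0≤b)) n!*sʲ≤nⁿ ⟩
        (A * powQ b n) * fromℕQ (n ^ n)
      ≡⟨ ℚ.*-assoc A (powQ b n) (fromℕQ (n ^ n)) ⟩
        A * (powQ b n * fromℕQ (n ^ n))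
      <⟨ *-monoˡ-<-0< (0<* (0<powQ n 0<b) (fromℕQ-mono-< {0} {n ^ n} 0<nⁿ)) A<ρⁿ ⟩
        powQ ρ n * (powQ b n * fromℕQ (n ^ n))
      ≡⟨ sym (ℚ.*-assoc (powQ ρ n) (powQ b n) (fromℕQ (n ^ n))) ⟩
        (powQ ρ n * powQ b n) * fromℕQ (n ^ n)
      ≡⟨ cong (_* fromℕQ (n ^ n)) (trans (sym (powQ-*-distrib ρ b n)) (trans (cong (λ z → powQ z n) ρb≡qs) (powQ-*-distrib q s n))) ⟩
        (powQ q n * powQ s n) * fromℕQ (n ^ n)
      ≡⟨ regroup′ (powQ q n) (powQ s n) (fromℕQ (n ^ n)) ⟩
        (powQ q n * fromℕQ (n ^ n)) * powQ s n
      ≡⟨ cong (_* powQ s n) (sym (trans (powQ-*-distrib q (fromℕQ n) n) (cong (powQ q n *_) (powQ-fromℕQ n n)))) ⟩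
        powQ (q * fromℕQ n) n * powQ s n ∎)
      where
      open ℚ.≤-Reasoning
      open ℚ-Solver.+-*-Solver
      j = n ∸ K
      K+j≡n : K ℕ.+ j ≡ n
      K+j≡n = ℕ.m+[n∸m]≡n K≤n
      0≤A : 0ℚ ≤ A
      0≤A = 0≤* (0≤fromℕQ (D ^ D)) (0≤powQ K 0≤s)
      0<b : 0ℚ < b
      0<b = ℚ.<-≤-trans 0<1 (x≤x+y (0≤Fr 1 D))
      0≤b : 0ℚ ≤ b
      0≤b = ℚ.<⇒≤ 0<b
      0<nⁿ : 0 ℕ.< n ^ n
      0<nⁿ = ℕ.^-monoʳ-≤ n {{>-nonZero (ℕ.≤-trans (s≤s z≤n) K≤n)}} (z≤n {n})
      n!*sʲ≤nⁿ : fromℕQ (n !) * powQ s j ≤ fromℕQ (n ^ n)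
      n!*sʲ≤nⁿ = subst (λ z → fromℕQ (z !) * powQ s j ≤ fromℕQ (z ^ z)) K+j≡n (!*powQ≤^ s 0≤s K′ s≤e j)
      regroup : ∀ F C B S₁ S₂ → (F * (C * B)) * (S₁ * S₂) ≡ ((C * S₁) * B) * (F * S₂)
      regroup = solve 5 (λ F C B S₁ S₂ → (F :* (C :* B)) :* (S₁ :* S₂) := ((C :* S₁) :* B) :* (F :* S₂)) refl
      regroup′ : ∀ Q S I → (Q * S) * I ≡ (Q * I) * S
      regroup′ = solve 3 (λ Q S I → (Q :* S) :* I := (Q :* I) :* S) refl

  module _ (q : ℚ) (m : ℕ) (1<q*s : 1ℚ < q * eSum m) where

    private
      s = eSum m
      K′ = suc m ℕ.* (m ℕ.* m) ℕ.* m ! ℕ.+ m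
      s≤e : ∀ k → K′ ℕ.≤ k → s ≤ powQ (1ℚ + Fr 1 (suc k)) (suc k)
      s≤e k K′≤k = eSum≤powQ-1+1/k m k
        (ℕ.≤-trans (ℕ.m≤n+m m (suc m ℕ.* (m ℕ.* m) ℕ.* m !)) (ℕ.≤-trans K′≤k (ℕ.n≤1+n k)))
        (ℕ.≤-trans (ℕ.m≤m+n (suc m ℕ.* (m ℕ.* m) ℕ.* m !) m) (ℕ.≤-trans K′≤k (ℕ.n≤1+n k)))
      0<q : 0ℚ < q
      0<q = *-cancelʳ-<-0≤ (0≤eSum m) (subst (_< q * s) (sym (ℚ.*-zeroˡ s)) (ℚ.<-trans 0<1 1<q*s))
      factor = 1<⇒[1+g/h]*[1+1/D]≡ (q * s) 1<q*s
      D′ = proj₁ factor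
      g = proj₁ (proj₂ factor)
      h′ = proj₁ (proj₂ (proj₂ factor))
      A = fromℕQ (suc D′ ^ suc D′) * powQ s (suc K′)
      growth = powQ-1+g/h-unbounded A (0≤* (0≤fromℕQ (suc D′ ^ suc D′)) (0≤powQ (suc K′) (0≤eSum m)))
                                    g h′ (proj₁ (proj₂ (proj₂ (proj₂ factor))))
      N₀ = proj₁ growth

    RootOverLt-f-S₀ : Σ ℕ λ N → ∀ n → N ℕ.≤ n → RootOverLt (f S₀ n) n q
    RootOverLt-f-S₀ = suc K′ ℕ.+ N₀ , λ n N≤n →
      0<q , f-S₀<[q*n]^n q s (0≤eSum m) K′ s≤e (1ℚ + Fr g (suc h′)) D′ (proj₂ (proj₂ (proj₂ (proj₂ factor)))) n
              (ℕ.≤-trans (ℕ.m≤m+n (suc K′) N₀) N≤n) (proj₂ growth n (ℕ.≤-trans (ℕ.m≤n+m N₀ (suc K′)) N≤n))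

proposition5p14 : ((n : ℕ) → n ≥ 1 → t S₀ n ≡ n !)
    × ((n : ℕ) → egf (t S₀) n ≡ xOver1mx n)
    × ((n : ℕ) → egf (f S₀) n ≡ expS xOver1mx n)
    × RootOverNTendsToInvE (f S₀)
proposition5p14 = ClosedForm.t-S₀≡! , Series.egf-t-S₀ , Series.egf-f-S₀ , root-over-n
  where
  root-over-n : RootOverNTendsToInvE (f S₀)
  root-over-n p q p<1/e (m , 1<q*eₘ) =
    proj₁ above , λ n N≤n n≥1 → LowerBound.LtRootOver-f-S₀ p p<1/e n n≥1 , proj₂ above n N≤n
    where
    above = UpperBound.RootOverLt-f-S₀ q m 1<q*eₘ
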